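{- Let $p$ be a prime greater than $2$, $m$ a positive integer, and $f \colon GF(p)^{2m} \to GF(p)$ a function of feasible Latin square type or of feasible negative Latin square type. Then for each nonzero $x \in GF(p)^{2m}$ there exists a unique index $j \in \{1, 2, \dots, p\}$ such that $\lambda_j(x) = N - r_j$, while $\lambda_i(x) = -r_i$ for all $i \in \{1,\dots,p\}$ with $i \ne j$.
   Context: Let $\zeta = e^{2\pi i/p}$, identify $GF(p)$ with $\{0,\dots,p-1\}$, $\langle\ ,\ \rangle$ the standard inner product. For $f$ even ($f(-x)=f(x)$) with $f(0)=0$: $D_i = f^{ -1}(i)$ for $1 \le i \le p-1$, $D_p = f^{ -1}(0)\setminus\{0\}$; $f_i$ is the indicator function of $D_i$; the component Cayley graph $\Gamma_i$ has vertex set $GF(p)^{2m}$, distinct $x,y$ adjacent iff $x-y\in D_i$. $\lambda_i(x) := \hat{f_i}(x) = \sum_y f_i(y)\zeta^{ -\langle x,y\rangle}$ (the eigenvalue of $\Gamma_i$ on the eigenvector $(\zeta^{ -\langle x,y\rangle})_y$). A strongly regular graph with parameters $(\nu,k,\lambda,\mu)$ is a $k$-regular graph on $\nu$ vertices in which adjacent vertices have $\lambda$ common neighbors and distinct nonadjacent vertices have $\mu$ common neighbors. $f$ is of feasible Latin square type (resp. feasible negative Latin square type) if $f$ is even, $f(0)=0$, and every $\Gamma_i$ ($1\le i\le p$) is strongly regular with parameters $(N^2, (N-1)r_i, N + r_i^2 - 3r_i, r_i^2 - r_i)$, where $N = p^m$ (resp. $N = -p^m$), $r_i = N/p$ for $1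 \le i \le p-1$, and $r_p = N/p + 1$. In the claim, $N$ and $r_i$ are these numbers. -}

module Defs where

open import Data.Bool using (Bool; true; false; if_then_else_; _∧_; not)
open import Data.Nat as ℕ using (ℕ; zero; suc; NonZero; _^_; _∸_; _<ᵇ_; _≡ᵇ_)
open import Data.Nat.DivMod using (_%_; m%n<n)
open import Data.Integer as ℤ using (ℤ; +_; -_; _-_)
open import Data.Fin as F using (Fin; toℕ; fromℕ<)
open import Data.Vec as V using (Vec; []; _∷_)
open import Data.Vec.Properties using (≡-dec)
open import Data.List as L using (List; [_]; length; filterᵇ; concatMap; map; allFin)
open import Data.Product using (Σ; ∃; _×_; _,_)
open import Relation.Nullary.Decidable using (isYes)
open import Relation.Binary.PropositionalEquality using (_≡_)

module GF (p : ℕ) .{{_ : NonZero p}} where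

  ofℕ : ℕ → Fin p
  ofℕ n = fromℕ< (m%n<n n p)

  0F : Fin p
  0F = ofℕ 0

  _+F_ _*F_ : Fin p → Fin p → Fin p
  a +F b = ofℕ (toℕ a ℕ.+ toℕ b)
  a *F b = ofℕ (toℕ a ℕ.* toℕ b)

  -F_ : Fin p → Fin p
  -F a = ofℕ (p ∸ toℕ a)

  _==F_ : Fin p → Fin p → Bool
  a ==F b = isYes (a F.≟ b)

  V0 : (n : ℕ) → Vec (Fin p) n
  V0 n = V.replicate n 0F

  vneg : ∀ {n} → Vec (Fin p) n → Vec (Fin p) n
  vneg = V.map -F_

  vsub : ∀ {n} → Vec (Fin p) n → Vec (Fin p) n → Vec (Fin p) n
  vsub x y = V.zipWith (λ a b → a +F (-F b)) x y

  ⟪_,_⟫ : ∀ {n} → Vec (Fin p) n → Vec (Fin p) n → Fin p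
  ⟪ x , y ⟫ = V.foldr _ _+F_ 0F (V.zipWith _*F_ x y)

  _==V_ : ∀ {n} → Vec (Fin p) n → Vec (Fin p) n → Bool
  x ==V y = isYes (≡-dec F._≟_ x y)

  -- enumeration of GF(p)^n (each vector exactly once)
  allVecs : (n : ℕ) → List (Vec (Fin p) n)
  allVecs zero = [ [] ]
  allVecs (suc n) = concatMap (λ a → map (a ∷_) (allVecs n)) (allFin p)

  count : ∀ {A : Set} → (A → Bool) → List A → ℕ
  count P xs = length (filterᵇ P xs)

  -- the sets D_i, 1 ≤ i ≤ p, as Boolean indicators f_i
  -- D_i = f⁻¹(i) for 1 ≤ i ≤ p-1,  D_p = f⁻¹(0) \ {0}
  module _ {n : ℕ} (f : Vec (Fin p) n → Fin p) where

    ind : ℕ → Vec (Fin p) n → Bool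
    ind i y = if i <ᵇ p then f y ==F ofℕ i
              else (f y ==F 0F) ∧ not (y ==V V0 n)

    adj : ℕ → Vec (Fin p) n → Vec (Fin p) n → Bool
    adj i x y = not (x ==V y) ∧ ind i (vsub x y)

    -- coefficients of λ_i(x) = Σ_y f_i(y) ζ^{-⟨x,y⟩} in ℤ[C_p]:
    -- coefficient of ζ^k is #{ y ∈ D_i : -⟨x,y⟩ = k }
    λcoeff : ℕ → Vec (Fin p) n → Fin p → ℤ
    λcoeff i x k = + count (λ y → ind i y ∧ ((-F ⟪ x , y ⟫) ==F k)) (allVecs n)

  -- ℤ[ζ] with ζ = e^{2πi/p}: elements Σ_k a_k ζ^k are coefficient
  -- functions a : Fin p → ℤ, i.e. ℤ[C_p], modulo the ideal generated by
  -- 1 + ζ + … + ζ^{p-1}, which is exactly the set of constant functions.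
  -- (ℤ[C_p]/(1+g+…+g^{p-1}) ≅ ℤ[x]/(Φ_p) ≅ ℤ[ζ] for p prime.)
  _≈ζ_ : (Fin p → ℤ) → (Fin p → ℤ) → Set
  a ≈ζ b = ∃ λ (c : ℤ) → ∀ k → a k - b k ≡ c

  intζ : ℤ → Fin p → ℤ
  intζ z k = if toℕ k ≡ᵇ 0 then z else + 0

  record IsSRG {V : Set} (vs : List V) (_==_ : V → V → Bool)
               (A : V → V → Bool) (ν k lam μ : ℤ) : Set where
    field
      vertices   : + length vs ≡ ν
      regular    : ∀ x → + count (A x) vs ≡ k
      adjacent   : ∀ x y → A x y ≡ true →
                   + count (λ z → A x z ∧ A y z) vs ≡ lam
      nonadjacent : ∀ x y → (x == y) ≡ false → A x y ≡ false →
                   + count (λ z → A x z ∧ A y z) vs ≡ μ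

  -- Parameters.  latin = true: N = p^m (Latin square type);
  -- latin = false: N = -p^m (negative Latin square type).
  -- N/p is written explicitly as ±p^(m-1) (m ≥ 1, so p ∣ p^m).
  Nval : Bool → ℕ → ℤ
  Nval true  m = + (p ^ m)
  Nval false m = - (+ (p ^ m))

  Nover : Bool → ℕ → ℤ
  Nover true  m = + (p ^ (m ∸ 1))
  Nover false m = - (+ (p ^ (m ∸ 1)))

  rval : Bool → ℕ → ℕ → ℤ
  rval s m i = if i <ᵇ p then Nover s m else Nover s m ℤ.+ + 1

  Even : ∀ {n} → (Vec (Fin p) n → Fin p) → Set
  Even f = ∀ x → f (vneg x) ≡ f x

  Feasible : Bool → (m : ℕ) → (Vec (Fin p) (2 ℕ.* m) → Fin p) → Set
  Feasible s m f =
    Even f × f (V0 (2 ℕ.* m)) ≡ 0F ×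
    (∀ i → 1 ℕ.≤ i → i ℕ.≤ p →
      let N = Nval s m ; r = rval s m i in
      IsSRG (allVecs (2 ℕ.* m)) _==V_ (adj f i)
            (N ℤ.* N) ((N - + 1) ℤ.* r)
            (N ℤ.+ r ℤ.* r - + 3 ℤ.* r) (r ℤ.* r - r))

-- The eigenvalues λ_i(x) are elements of ℤ[ζ], modelled as ℤ[C_p] modulo constants. Since Γ_i is
-- strongly regular with the Latin square parameters, and the character sum Σ_y ζ^(-⟨x,y⟩) is
-- constant for x ≠ 0, the eigenvalue θ = λ_i(x) satisfies (θ - (N - r_i)) (θ + r_i) = 0. The
-- ring ℤ[ζ] has no zero divisors: if p divides a product, one factor has augmentation divisible by
-- p, hence is divisible by π = 1 - ζ, and π^(p-1) is divisible by p; this lets one divide p out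
-- of a factor and descend. So θ ∈ {N - r_i, -r_i}. Finally D_1, …, D_p partition the nonzero
-- vectors, so Σ_i λ_i(x) = -1, while Σ_i r_i = N + 1: the numbers λ_i(x) + r_i ∈ {0, N} add up
-- to N, so exactly one of them is N.
module Submission where

module _ where
  open import Defs
  open import Data.Bool using (Bool; true; false; if_then_else_; _∧_; not; T)
  open import Data.Bool.Properties using (∧-idem; ∧-zeroʳ; T-≡)
  open import Function.Bundles using (Equivalence)
  open import Data.Nat as ℕ using (ℕ; zero; suc; NonZero; _≤_; _<_; z≤n; s≤s; _<ᵇ_; _^_; _∸_)
  import Data.Nat.Properties as ℕP
  open import Data.Nat.DivMod using (_%_; m%n<n; m<n⇒m%n≡m; n%n≡0; m%n%n≡m%n; %-distribˡ-+; %-distribˡ-*; [m+kn]%n≡m%n)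
  import Data.Nat.Divisibility as ℕ∣
  open import Data.Nat.Primality using (Prime; euclidsLemma; prime⇒irreducible; prime⇒nonTrivial)
  open import Data.Nat.Combinatorics using (_C_; nCk+nC[k+1]≡[n+1]C[k+1]; nC1≡n; k>n⇒nCk≡0)
  open import Data.Nat.Coprimality using (Coprime; coprime⇒GCD≡1)
  open import Data.Nat.GCD using (module Bézout)
  open import Data.Integer as ℤ using (ℤ; +_; -_; _+_; _-_; _*_)
  import Data.Integer.Properties as ℤP
  open import Data.Integer.Divisibility.Signed using (_∣_; divides; ∣ᵤ⇒∣; ∣⇒∣ᵤ; ∣m∣n⇒∣m-n; ∣n⇒∣m*n)
  open import Data.Integer.Tactic.RingSolver using (solve-∀)
  open import Data.Fin as F using (Fin; toℕ; fromℕ<)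
  import Data.Fin.Properties as FP
  open import Data.Fin.Permutation using (permutation)
  open import Data.Vec as V using (Vec; []; _∷_)
  import Data.Vec.Properties as VP
  open import Data.List as L using (List; []; _∷_; _++_; concatMap; tabulate)
  open import Data.Product using (Σ; ∃; _×_; _,_; proj₁; proj₂; map₂)
  open import Data.Sum as Sum using (_⊎_; inj₁; inj₂; [_,_]′)
  open import Data.Empty using (⊥; ⊥-elim)
  open import Data.Unit using (tt)
  open import Function using (_∘_; id)
  open import Relation.Nullary using (Dec; yes; no; ¬_)
  open import Relation.Nullary.Decidable using (isYes)
  open import Relation.Binary.PropositionalEquality hiding ([_])
  open ≡-Reasoning
  open import Algebra.Properties.Semiring.Sum ℤP.+-*-semiring
    using (sum; sum-permute; sum-cong-≗; ∑-distrib-+; *-distribˡ-sum; *-distribʳ-sum; sum-replicate-zero; ∑-comm)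
  import Algebra.Properties.Semiring.Sum ℕP.+-*-semiring as ℕΣ
  open import Algebra.Properties.AbelianGroup ℤP.+-0-abelianGroup using () renaming (∙-cancelˡ to +-cancelˡ)

  -- Arithmetic in GF(p)

  module ModularArithmetic (p : ℕ) .{{_ : NonZero p}} where
    open GF p

    _⊖_ : Fin p → Fin p → Fin p
    a ⊖ b = a +F (-F b)

    toℕ-ofℕ : ∀ n → toℕ (ofℕ n) ≡ n % p
    toℕ-ofℕ n = FP.toℕ-fromℕ< (m%n<n n p)

    ofℕ-toℕ : ∀ (a : Fin p) → ofℕ (toℕ a) ≡ a
    ofℕ-toℕ a = FP.toℕ-injective (trans (toℕ-ofℕ (toℕ a)) (m<n⇒m%n≡m (FP.toℕ<n a)))

    ofℕ-cong-% : ∀ {m n} → m % p ≡ n % p → ofℕ m ≡ ofℕ n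
    ofℕ-cong-% {m} {n} e = FP.toℕ-injective (trans (toℕ-ofℕ m) (trans e (sym (toℕ-ofℕ n))))

    toℕ-0F : toℕ 0F ≡ 0
    toℕ-0F = trans (toℕ-ofℕ 0) (m<n⇒m%n≡m (ℕ.>-nonZero⁻¹ p))

    ofℕ-absorbˡ-+ : ∀ x y → ofℕ (toℕ (ofℕ x) ℕ.+ y) ≡ ofℕ (x ℕ.+ y)
    ofℕ-absorbˡ-+ x y = ofℕ-cong-% (begin
      (toℕ (ofℕ x) ℕ.+ y) % p     ≡⟨ cong (λ z → (z ℕ.+ y) % p) (toℕ-ofℕ x) ⟩
      (x % p ℕ.+ y) % p           ≡⟨ %-distribˡ-+ (x % p) y p ⟩
      (x % p % p ℕ.+ y % p) % p   ≡⟨ cong (λ z → (z ℕ.+ y % p) % p) (m%n%n≡m%n x p) ⟩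
      (x % p ℕ.+ y % p) % p       ≡⟨ %-distribˡ-+ x y p ⟨
      (x ℕ.+ y) % p               ∎)

    ofℕ-absorbʳ-+ : ∀ x y → ofℕ (x ℕ.+ toℕ (ofℕ y)) ≡ ofℕ (x ℕ.+ y)
    ofℕ-absorbʳ-+ x y = begin
      ofℕ (x ℕ.+ toℕ (ofℕ y)) ≡⟨ cong ofℕ (ℕP.+-comm x _) ⟩
      ofℕ (toℕ (ofℕ y) ℕ.+ x) ≡⟨ ofℕ-absorbˡ-+ y x ⟩
      ofℕ (y ℕ.+ x)           ≡⟨ cong ofℕ (ℕP.+-comm y x) ⟩
      ofℕ (x ℕ.+ y)           ∎

    ofℕ-absorbˡ-* : ∀ x y → ofℕ (toℕ (ofℕ x) ℕ.* y) ≡ ofℕ (x ℕ.* y)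
    ofℕ-absorbˡ-* x y = ofℕ-cong-% (begin
      (toℕ (ofℕ x) ℕ.* y) % p       ≡⟨ cong (λ z → (z ℕ.* y) % p) (toℕ-ofℕ x) ⟩
      (x % p ℕ.* y) % p             ≡⟨ %-distribˡ-* (x % p) y p ⟩
      (x % p % p ℕ.* (y % p)) % p   ≡⟨ cong (λ z → (z ℕ.* (y % p)) % p) (m%n%n≡m%n x p) ⟩
      (x % p ℕ.* (y % p)) % p       ≡⟨ %-distribˡ-* x y p ⟨
      (x ℕ.* y) % p                 ∎)

    ofℕ-absorbʳ-* : ∀ x y → ofℕ (x ℕ.* toℕ (ofℕ y)) ≡ ofℕ (x ℕ.* y)
    ofℕ-absorbʳ-* x y = begin
      ofℕ (x ℕ.* toℕ (ofℕ y)) ≡⟨ cong ofℕ (ℕP.*-comm x _) ⟩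
      ofℕ (toℕ (ofℕ y) ℕ.* x) ≡⟨ ofℕ-absorbˡ-* y x ⟩
      ofℕ (y ℕ.* x)           ≡⟨ cong ofℕ (ℕP.*-comm y x) ⟩
      ofℕ (x ℕ.* y)           ∎

    +F-comm : ∀ a b → a +F b ≡ b +F a
    +F-comm a b = cong ofℕ (ℕP.+-comm (toℕ a) (toℕ b))

    *F-comm : ∀ a b → a *F b ≡ b *F a
    *F-comm a b = cong ofℕ (ℕP.*-comm (toℕ a) (toℕ b))

    +F-assoc : ∀ a b c → (a +F b) +F c ≡ a +F (b +F c)
    +F-assoc a b c = begin
      ofℕ (toℕ (ofℕ (toℕ a ℕ.+ toℕ b)) ℕ.+ toℕ c) ≡⟨ ofℕ-absorbˡ-+ (toℕ a ℕ.+ toℕ b) (toℕ c) ⟩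
      ofℕ (toℕ a ℕ.+ toℕ b ℕ.+ toℕ c)             ≡⟨ cong ofℕ (ℕP.+-assoc (toℕ a) _ _) ⟩
      ofℕ (toℕ a ℕ.+ (toℕ b ℕ.+ toℕ c))           ≡⟨ ofℕ-absorbʳ-+ (toℕ a) (toℕ b ℕ.+ toℕ c) ⟨
      ofℕ (toℕ a ℕ.+ toℕ (ofℕ (toℕ b ℕ.+ toℕ c))) ∎

    *F-assoc : ∀ a b c → (a *F b) *F c ≡ a *F (b *F c)
    *F-assoc a b c = begin
      ofℕ (toℕ (ofℕ (toℕ a ℕ.* toℕ b)) ℕ.* toℕ c) ≡⟨ ofℕ-absorbˡ-* (toℕ a ℕ.* toℕ b) (toℕ c) ⟩
      ofℕ (toℕ a ℕ.* toℕ b ℕ.* toℕ c)             ≡⟨ cong ofℕ (ℕP.*-assoc (toℕ a) _ _) ⟩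
      ofℕ (toℕ a ℕ.* (toℕ b ℕ.* toℕ c))           ≡⟨ ofℕ-absorbʳ-* (toℕ a) (toℕ b ℕ.* toℕ c) ⟨
      ofℕ (toℕ a ℕ.* toℕ (ofℕ (toℕ b ℕ.* toℕ c))) ∎

    *F-distribˡ-+F : ∀ a b c → a *F (b +F c) ≡ (a *F b) +F (a *F c)
    *F-distribˡ-+F a b c = begin
      ofℕ (toℕ a ℕ.* toℕ (ofℕ (toℕ b ℕ.+ toℕ c)))  ≡⟨ ofℕ-absorbʳ-* (toℕ a) (toℕ b ℕ.+ toℕ c) ⟩
      ofℕ (toℕ a ℕ.* (toℕ b ℕ.+ toℕ c))            ≡⟨ cong ofℕ (ℕP.*-distribˡ-+ (toℕ a) _ _) ⟩
      ofℕ (ab ℕ.+ ac)                              ≡⟨ ofℕ-absorbˡ-+ ab ac ⟨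
      ofℕ (toℕ (ofℕ ab) ℕ.+ ac)                    ≡⟨ ofℕ-absorbʳ-+ (toℕ (ofℕ ab)) ac ⟨
      ofℕ (toℕ (ofℕ ab) ℕ.+ toℕ (ofℕ ac))          ∎
      where ab = toℕ a ℕ.* toℕ b ; ac = toℕ a ℕ.* toℕ c

    +F-identityˡ : ∀ a → 0F +F a ≡ a
    +F-identityˡ a = trans (ofℕ-absorbˡ-+ 0 (toℕ a)) (ofℕ-toℕ a)

    +F-identityʳ : ∀ a → a +F 0F ≡ a
    +F-identityʳ a = trans (+F-comm a 0F) (+F-identityˡ a)

    1F : Fin p
    1F = ofℕ 1

    *F-identityˡ : ∀ a → 1F *F a ≡ a
    *F-identityˡ a = trans (ofℕ-absorbˡ-* 1 (toℕ a)) (trans (cong ofℕ (ℕP.*-identityˡ (toℕ a))) (ofℕ-toℕ a))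

    *F-zeroˡ : ∀ a → 0F *F a ≡ 0F
    *F-zeroˡ a = ofℕ-absorbˡ-* 0 (toℕ a)

    *F-zeroʳ : ∀ a → a *F 0F ≡ 0F
    *F-zeroʳ a = trans (*F-comm a 0F) (*F-zeroˡ a)

    +F-inverseʳ : ∀ a → a +F (-F a) ≡ 0F
    +F-inverseʳ a = begin
      ofℕ (toℕ a ℕ.+ toℕ (ofℕ (p ∸ toℕ a))) ≡⟨ ofℕ-absorbʳ-+ (toℕ a) (p ∸ toℕ a) ⟩
      ofℕ (toℕ a ℕ.+ (p ∸ toℕ a))           ≡⟨ cong ofℕ (ℕP.m+[n∸m]≡n (ℕP.<⇒≤ (FP.toℕ<n a))) ⟩
      ofℕ p                                 ≡⟨ ofℕ-cong-% (trans (n%n≡0 p) (sym (m<n⇒m%n≡m (ℕ.>-nonZero⁻¹ p)))) ⟩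
      ofℕ 0                                 ∎

    +F-inverseˡ : ∀ a → (-F a) +F a ≡ 0F
    +F-inverseˡ a = trans (+F-comm _ a) (+F-inverseʳ a)

    +F-cancelʳ : ∀ {a b} c → a +F c ≡ b +F c → a ≡ b
    +F-cancelʳ {a} {b} c e = begin
      a                   ≡⟨ +F-identityʳ a ⟨
      a +F 0F             ≡⟨ cong (a +F_) (+F-inverseʳ c) ⟨
      a +F (c +F (-F c))  ≡⟨ +F-assoc a c _ ⟨
      (a +F c) +F (-F c)  ≡⟨ cong (_+F (-F c)) e ⟩
      (b +F c) +F (-F c)  ≡⟨ +F-assoc b c _ ⟩
      b +F (c +F (-F c))  ≡⟨ cong (b +F_) (+F-inverseʳ c) ⟩
      b +F 0F             ≡⟨ +F-identityʳ b ⟩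
      b                   ∎

    [a+b]⊖b≡a : ∀ a b → (a +F b) ⊖ b ≡ a
    [a+b]⊖b≡a a b = trans (+F-assoc a b _) (trans (cong (a +F_) (+F-inverseʳ b)) (+F-identityʳ a))

    [a⊖b]+b≡a : ∀ a b → (a ⊖ b) +F b ≡ a
    [a⊖b]+b≡a a b = trans (+F-assoc a _ b) (trans (cong (a +F_) (+F-inverseˡ b)) (+F-identityʳ a))

    a+b≡c⇒a≡c⊖b : ∀ {a b c} → a +F b ≡ c → a ≡ c ⊖ b
    a+b≡c⇒a≡c⊖b {a} {b} refl = sym ([a+b]⊖b≡a a b)

    a≡c⊖b⇒a+b≡c : ∀ {a b c} → a ≡ c ⊖ b → a +F b ≡ c
    a≡c⊖b⇒a+b≡c {b = b} {c} refl = [a⊖b]+b≡a c b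

    -F-involutive : ∀ a → -F (-F a) ≡ a
    -F-involutive a = +F-cancelʳ (-F a) (trans (+F-inverseˡ (-F a)) (sym (+F-inverseʳ a)))

    -F-0F : -F 0F ≡ 0F
    -F-0F = trans (sym (+F-identityˡ (-F 0F))) (+F-inverseʳ 0F)

    -F-distrib-+F : ∀ a b → -F (a +F b) ≡ (-F a) +F (-F b)
    -F-distrib-+F a b = +F-cancelʳ (a +F b) (trans (+F-inverseˡ (a +F b)) (sym (begin
      ((-F a) +F (-F b)) +F (a +F b)  ≡⟨ cong (((-F a) +F (-F b)) +F_) (+F-comm a b) ⟩
      ((-F a) +F (-F b)) +F (b +F a)  ≡⟨ +F-assoc (-F a) _ _ ⟩
      (-F a) +F ((-F b) +F (b +F a))  ≡⟨ cong ((-F a) +F_) (+F-assoc (-F b) b a) ⟨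
      (-F a) +F (((-F b) +F b) +F a)  ≡⟨ cong (λ z → (-F a) +F (z +F a)) (+F-inverseˡ b) ⟩
      (-F a) +F (0F +F a)             ≡⟨ cong ((-F a) +F_) (+F-identityˡ a) ⟩
      (-F a) +F a                     ≡⟨ +F-inverseˡ a ⟩
      0F                              ∎)))

    -F-distribʳ-*F : ∀ a b → a *F (-F b) ≡ -F (a *F b)
    -F-distribʳ-*F a b = +F-cancelʳ (a *F b) (begin
      (a *F (-F b)) +F (a *F b)  ≡⟨ *F-distribˡ-+F a (-F b) b ⟨
      a *F ((-F b) +F b)         ≡⟨ cong (a *F_) (+F-inverseˡ b) ⟩
      a *F 0F                    ≡⟨ *F-zeroʳ a ⟩
      0F                         ≡⟨ +F-inverseˡ (a *F b) ⟨
      (-F (a *F b)) +F (a *F b)  ∎)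

    a⊖[a⊖b]≡b : ∀ a b → a ⊖ (a ⊖ b) ≡ b
    a⊖[a⊖b]≡b a b = begin
      a +F (-F (a +F (-F b)))       ≡⟨ cong (a +F_) (-F-distrib-+F a (-F b)) ⟩
      a +F ((-F a) +F (-F (-F b)))  ≡⟨ +F-assoc a (-F a) _ ⟨
      (a +F (-F a)) +F (-F (-F b))  ≡⟨ cong₂ _+F_ (+F-inverseʳ a) (-F-involutive b) ⟩
      0F +F b                       ≡⟨ +F-identityˡ b ⟩
      b                             ∎

    a⊖[b+c]≡[a⊖c]⊖b : ∀ a b c → a ⊖ (b +F c) ≡ (a ⊖ c) ⊖ b
    a⊖[b+c]≡[a⊖c]⊖b a b c = begin
      a +F (-F (b +F c))       ≡⟨ cong (a +F_) (trans (-F-distrib-+F b c) (+F-comm (-F b) (-F c))) ⟩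
      a +F ((-F c) +F (-F b))  ≡⟨ +F-assoc a (-F c) (-F b) ⟨
      (a +F (-F c)) +F (-F b)  ∎

    a⊖0≡a : ∀ a → a ⊖ 0F ≡ a
    a⊖0≡a a = trans (cong (a +F_) -F-0F) (+F-identityʳ a)

  isYes≡true⇒ : ∀ {A : Set} (d : Dec A) → isYes d ≡ true → A
  isYes≡true⇒ (yes a) _ = a

  isYes≡true : ∀ {A : Set} (d : Dec A) → A → isYes d ≡ true
  isYes≡true (yes _) _ = refl
  isYes≡true (no ¬a) a = ⊥-elim (¬a a)

  isYes≡false : ∀ {A : Set} (d : Dec A) → ¬ A → isYes d ≡ false
  isYes≡false (yes a) ¬a = ⊥-elim (¬a a)
  isYes≡false (no _) _ = refl

  isYes-cong : ∀ {A B : Set} (d : Dec A) (d′ : Dec B) → (A → B) → (B → A) → isYes d ≡ isYes d′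
  isYes-cong (yes a) d′ f g = sym (isYes≡true d′ (f a))
  isYes-cong (no ¬a) d′ f g = sym (isYes≡false d′ (¬a ∘ g))

  module Vectors (p : ℕ) .{{_ : NonZero p}} where
    open GF p
    open ModularArithmetic p

    vadd : ∀ {n} → Vec (Fin p) n → Vec (Fin p) n → Vec (Fin p) n
    vadd = V.zipWith _+F_

    vsub-vadd : ∀ {n} (v w : Vec (Fin p) n) → vsub (vadd v w) w ≡ v
    vsub-vadd [] [] = refl
    vsub-vadd (a ∷ v) (b ∷ w) = cong₂ _∷_ ([a+b]⊖b≡a a b) (vsub-vadd v w)

    vsub-V0ˡ : ∀ {n} (w : Vec (Fin p) n) → vsub (V0 n) w ≡ vneg w
    vsub-V0ˡ [] = refl
    vsub-V0ˡ (b ∷ w) = cong₂ _∷_ (+F-identityˡ (-F b)) (vsub-V0ˡ w)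

    vsub-V0ʳ : ∀ {n} (w : Vec (Fin p) n) → vsub w (V0 n) ≡ w
    vsub-V0ʳ [] = refl
    vsub-V0ʳ (b ∷ w) = cong₂ _∷_ (trans (cong (b +F_) -F-0F) (+F-identityʳ b)) (vsub-V0ʳ w)

    vsub-self : ∀ {n} (w : Vec (Fin p) n) → vsub w w ≡ V0 n
    vsub-self [] = refl
    vsub-self (b ∷ w) = cong₂ _∷_ (+F-inverseʳ b) (vsub-self w)

    vneg-involutive : ∀ {n} (w : Vec (Fin p) n) → vneg (vneg w) ≡ w
    vneg-involutive [] = refl
    vneg-involutive (b ∷ w) = cong₂ _∷_ (-F-involutive b) (vneg-involutive w)

    vneg-V0 : ∀ n → vneg (V0 n) ≡ V0 n
    vneg-V0 zero = refl
    vneg-V0 (suc n) = cong₂ _∷_ -F-0F (vneg-V0 n)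

    ⟪⟫-vadd : ∀ {n} (x u v : Vec (Fin p) n) → ⟪ x , vadd u v ⟫ ≡ ⟪ x , u ⟫ +F ⟪ x , v ⟫
    ⟪⟫-vadd [] [] [] = sym (+F-identityˡ 0F)
    ⟪⟫-vadd (a ∷ x) (b ∷ u) (c ∷ v) = begin
      (a *F (b +F c)) +F ⟪ x , vadd u v ⟫                  ≡⟨ cong₂ _+F_ (*F-distribˡ-+F a b c) (⟪⟫-vadd x u v) ⟩
      ((a *F b) +F (a *F c)) +F (⟪ x , u ⟫ +F ⟪ x , v ⟫)   ≡⟨ interchange (a *F b) (a *F c) ⟪ x , u ⟫ ⟪ x , v ⟫ ⟩
      ((a *F b) +F ⟪ x , u ⟫) +F ((a *F c) +F ⟪ x , v ⟫)   ∎
      where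
      interchange : ∀ a b c d → (a +F b) +F (c +F d) ≡ (a +F c) +F (b +F d)
      interchange a b c d = begin
        (a +F b) +F (c +F d)  ≡⟨ +F-assoc a b _ ⟩
        a +F (b +F (c +F d))  ≡⟨ cong (a +F_) (+F-assoc b c d) ⟨
        a +F ((b +F c) +F d)  ≡⟨ cong (λ z → a +F (z +F d)) (+F-comm b c) ⟩
        a +F ((c +F b) +F d)  ≡⟨ cong (a +F_) (+F-assoc c b d) ⟩
        a +F (c +F (b +F d))  ≡⟨ +F-assoc a c _ ⟨
        (a +F c) +F (b +F d)  ∎

    ⟪⟫-V0ʳ : ∀ {n} (x : Vec (Fin p) n) → ⟪ x , V0 n ⟫ ≡ 0F
    ⟪⟫-V0ʳ [] = refl
    ⟪⟫-V0ʳ (a ∷ x) = trans (cong₂ _+F_ (*F-zeroʳ a) (⟪⟫-V0ʳ x)) (+F-identityˡ 0F)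

    ==V⇒≡ : ∀ {n} {x y : Vec (Fin p) n} → (x ==V y) ≡ true → x ≡ y
    ==V⇒≡ {x = x} {y} = isYes≡true⇒ (VP.≡-dec F._≟_ x y)

    ==V-refl : ∀ {n} (x : Vec (Fin p) n) → (x ==V x) ≡ true
    ==V-refl x = isYes≡true (VP.≡-dec F._≟_ x x) refl

    ==V-∷ : ∀ {n} a (ys : Vec (Fin p) n) c cs → ((a ∷ ys) ==V (c ∷ cs)) ≡ (isYes (c F.≟ a) ∧ (ys ==V cs))
    ==V-∷ a ys c cs with c F.≟ a
    ... | yes refl = isYes-cong (VP.≡-dec F._≟_ (a ∷ ys) (a ∷ cs)) (VP.≡-dec F._≟_ ys cs)
                       (λ e → proj₂ (VP.∷-injective e)) (cong (a ∷_))
    ... | no c≢a = isYes≡false (VP.≡-dec F._≟_ (a ∷ ys) (c ∷ cs)) (λ e → c≢a (sym (proj₁ (VP.∷-injective e))))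

    vneg-==V0 : ∀ {n} (y : Vec (Fin p) n) → (vneg y ==V V0 n) ≡ (y ==V V0 n)
    vneg-==V0 {n} y = isYes-cong (VP.≡-dec F._≟_ (vneg y) (V0 n)) (VP.≡-dec F._≟_ y (V0 n))
      (λ e → trans (sym (vneg-involutive y)) (trans (cong vneg e) (vneg-V0 n)))
      (λ e → trans (cong vneg e) (vneg-V0 n))

    ==F-refl : ∀ (x : Fin p) → (x ==F x) ≡ true
    ==F-refl x = isYes≡true (x F.≟ x) refl

    ==F-false : ∀ {x y : Fin p} → x ≢ y → (x ==F y) ≡ false
    ==F-false {x} {y} = isYes≡false (x F.≟ y)

  -- Finite sums

  ⟦_⟧ : Bool → ℤ
  ⟦ true ⟧ = + 1
  ⟦ false ⟧ = + 0

  ⟦∧⟧ : ∀ a b → ⟦ a ∧ b ⟧ ≡ ⟦ a ⟧ * ⟦ b ⟧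
  ⟦∧⟧ true true = refl
  ⟦∧⟧ true false = refl
  ⟦∧⟧ false b = refl

  ⟦not⟧ : ∀ b → ⟦ not b ⟧ ≡ + 1 - ⟦ b ⟧
  ⟦not⟧ true = refl
  ⟦not⟧ false = refl

  sum-reindex : ∀ {n} (h : Fin n → ℤ) (f g : Fin n → Fin n) → (∀ x → f (g x) ≡ x) → (∀ x → g (f x) ≡ x) →
                sum h ≡ sum (h ∘ f)
  sum-reindex h f g fg gf = sum-permute h (permutation f g fg gf)

  sum-*ˡ : ∀ {n} c (f : Fin n → ℤ) → sum (λ i → c * f i) ≡ c * sum f
  sum-*ˡ c f = sym (*-distribˡ-sum c f)

  sum-*ʳ : ∀ {n} c (f : Fin n → ℤ) → sum (λ i → f i * c) ≡ sum f * c
  sum-*ʳ c f = sym (*-distribʳ-sum c f)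

  sum-zero : ∀ {n} (f : Fin n → ℤ) → (∀ i → f i ≡ + 0) → sum f ≡ + 0
  sum-zero {n} f e = trans (sum-cong-≗ e) (sum-replicate-zero n)

  sum-neg : ∀ {n} (f : Fin n → ℤ) → sum (λ i → - f i) ≡ - sum f
  sum-neg f = begin
    sum (λ i → - f i)        ≡⟨ sum-cong-≗ (λ i → sym (ℤP.-1*i≡-i (f i))) ⟩
    sum (λ i → - + 1 * f i)  ≡⟨ sum-*ˡ (- + 1) f ⟩
    - + 1 * sum f            ≡⟨ ℤP.-1*i≡-i (sum f) ⟩
    - sum f                  ∎

  sum-distrib-sub : ∀ {n} (f g : Fin n → ℤ) → sum (λ i → f i - g i) ≡ sum f - sum g
  sum-distrib-sub f g = trans (∑-distrib-+ f (λ i → - g i)) (cong (λ z → sum f + z) (sum-neg g))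

  sum-const : ∀ n c → sum {n} (λ _ → c) ≡ + n * c
  sum-const zero c = sym (ℤP.*-zeroˡ c)
  sum-const (suc n) c = begin
    c + sum {n} (λ _ → c)  ≡⟨ cong (λ z → c + z) (sum-const n c) ⟩
    c + + n * c            ≡⟨ cong (_+ + n * c) (ℤP.*-identityˡ c) ⟨
    + 1 * c + + n * c      ≡⟨ ℤP.*-distribʳ-+ c (+ 1) (+ n) ⟨
    + suc n * c            ∎

  sum-δ : ∀ {n} (c : Fin n) (g : Fin n → ℤ) → sum (λ j → ⟦ isYes (c F.≟ j) ⟧ * g j) ≡ g c
  sum-δ {suc n} F.zero g = begin
    + 1 * g F.zero + sum (λ j → + 0 * g (F.suc j))
      ≡⟨ cong₂ _+_ (ℤP.*-identityˡ (g F.zero)) (sum-zero _ (λ j → ℤP.*-zeroˡ (g (F.suc j)))) ⟩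
    g F.zero + + 0  ≡⟨ ℤP.+-identityʳ _ ⟩
    g F.zero        ∎
  sum-δ {suc n} (F.suc c) g = begin
    + 0 * g F.zero + sum (λ j → ⟦ isYes (F.suc c F.≟ F.suc j) ⟧ * g (F.suc j))
      ≡⟨ cong₂ _+_ (ℤP.*-zeroˡ (g F.zero)) (sum-cong-≗ (λ j → cong (λ b → ⟦ b ⟧ * g (F.suc j)) (suc≟suc j))) ⟩
    + 0 + sum (λ j → ⟦ isYes (c F.≟ j) ⟧ * g (F.suc j))  ≡⟨ ℤP.+-identityˡ _ ⟩
    sum (λ j → ⟦ isYes (c F.≟ j) ⟧ * g (F.suc j))        ≡⟨ sum-δ c (g ∘ F.suc) ⟩
    g (F.suc c)                                         ∎
    where
    suc≟suc : ∀ j → isYes (F.suc c F.≟ F.suc j) ≡ isYes (c F.≟ j)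
    suc≟suc j with c F.≟ j
    ... | yes _ = refl
    ... | no _ = refl

  sum-iverson-ℕ : ∀ {n} (b : Fin n → Bool) → ∃ λ k → sum (⟦_⟧ ∘ b) ≡ + k
  sum-iverson-ℕ {zero} b = 0 , refl
  sum-iverson-ℕ {suc n} b with b F.zero | sum-iverson-ℕ (b ∘ F.suc)
  ... | true  | k , e = suc k , trans (cong (λ z → + 1 + z) e) (sym (ℤP.pos-+ 1 k))
  ... | false | k , e = k , trans (cong (λ z → + 0 + z) e) (ℤP.+-identityˡ (+ k))

  sum-iverson≡0 : ∀ {n} (b : Fin n → Bool) → sum (⟦_⟧ ∘ b) ≡ + 0 → ∀ t → b t ≡ false
  sum-iverson≡0 {suc n} b s≡0 t with b F.zero in b₀ | sum-iverson-ℕ (b ∘ F.suc)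
  ... | true | k , e = ⊥-elim (ℕP.0≢1+n (sym (ℤP.+-injective (begin
          + suc k          ≡⟨ ℤP.pos-+ 1 k ⟩
          + 1 + + k        ≡⟨ cong (λ z → + 1 + z) e ⟨
          + 1 + sum (⟦_⟧ ∘ b ∘ F.suc)  ≡⟨ s≡0 ⟩
          + 0              ∎))))
  sum-iverson≡0 {suc n} b s≡0 F.zero | false | _ = b₀
  sum-iverson≡0 {suc n} b s≡0 (F.suc t) | false | _ =
    sum-iverson≡0 (b ∘ F.suc) (trans (sym (ℤP.+-identityˡ _)) s≡0) t

  sum-iverson≡1 : ∀ {n} (b : Fin n → Bool) → sum (⟦_⟧ ∘ b) ≡ + 1 →
                  ∃ λ t → b t ≡ true × (∀ u → u ≢ t → b u ≡ false)
  sum-iverson≡1 {suc n} b s≡1 with b F.zero in b₀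
  ... | true = F.zero , b₀ , others
    where
    rest≡0 : sum (⟦_⟧ ∘ b ∘ F.suc) ≡ + 0
    rest≡0 = +-cancelˡ (+ 1) _ _ (trans s≡1 (sym (ℤP.+-identityʳ (+ 1))))
    others : ∀ u → u ≢ F.zero → b u ≡ false
    others F.zero u≢0 = ⊥-elim (u≢0 refl)
    others (F.suc u) _ = sum-iverson≡0 (b ∘ F.suc) rest≡0 u
  ... | false with sum-iverson≡1 (b ∘ F.suc) (trans (sym (ℤP.+-identityˡ _)) s≡1)
  ...   | t , bt , others = F.suc t , bt , others′
    where
    others′ : ∀ u → u ≢ F.suc t → b u ≡ false
    others′ F.zero _ = b₀
    others′ (F.suc u) u≢t = others u (u≢t ∘ cong F.suc)

  count-++ : ∀ {A : Set} (P : A → Bool) (xs ys : List A) →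
             L.length (L.filterᵇ P (xs ++ ys)) ≡ L.length (L.filterᵇ P xs) ℕ.+ L.length (L.filterᵇ P ys)
  count-++ P [] ys = refl
  count-++ P (x ∷ xs) ys with P x
  ... | true = cong suc (count-++ P xs ys)
  ... | false = count-++ P xs ys

  count-map : ∀ {A B : Set} (P : B → Bool) (f : A → B) (xs : List A) →
              L.length (L.filterᵇ P (L.map f xs)) ≡ L.length (L.filterᵇ (P ∘ f) xs)
  count-map P f [] = refl
  count-map P f (x ∷ xs) with P (f x)
  ... | true = cong suc (count-map P f xs)
  ... | false = count-map P f xs

  count-concatMap : ∀ {A B : Set} {n} (P : A → Bool) (g : Fin n → B) (h : B → List A) →
    + L.length (L.filterᵇ P (concatMap h (tabulate g))) ≡ sum (λ i → + L.length (L.filterᵇ P (h (g i))))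
  count-concatMap {n = zero} P g h = refl
  count-concatMap {n = suc n} P g h = begin
    + L.length (L.filterᵇ P (h (g F.zero) ++ concatMap h (tabulate (g ∘ F.suc))))
      ≡⟨ cong +_ (count-++ P (h (g F.zero)) _) ⟩
    + L.length (L.filterᵇ P (h (g F.zero))) + + L.length (L.filterᵇ P (concatMap h (tabulate (g ∘ F.suc))))
      ≡⟨ cong (λ z → + L.length (L.filterᵇ P (h (g F.zero))) + z) (count-concatMap P (g ∘ F.suc) h) ⟩
    sum (λ i → + L.length (L.filterᵇ P (h (g i)))) ∎

  count-cong : ∀ {A : Set} {P Q : A → Bool} (xs : List A) → (∀ w → P w ≡ Q w) →
               L.length (L.filterᵇ P xs) ≡ L.length (L.filterᵇ Q xs)
  count-cong [] e = refl
  count-cong {P = P} {Q} (x ∷ xs) e with P x | Q x | e x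
  ... | true  | .true  | refl = cong suc (count-cong xs e)
  ... | false | .false | refl = count-cong xs e

  module VectorSums (p : ℕ) .{{_ : NonZero p}} where
    open GF p
    open ModularArithmetic p
    open Vectors p

    sum-translate : ∀ (h : Fin p → ℤ) c → sum h ≡ sum (λ a → h (a +F c))
    sum-translate h c = sum-reindex h (_+F c) (_⊖ c) (λ a → [a⊖b]+b≡a a c) (λ a → [a+b]⊖b≡a a c)

    vsum : (n : ℕ) → (Vec (Fin p) n → ℤ) → ℤ
    vsum zero g = g []
    vsum (suc n) g = sum (λ a → vsum n (λ ys → g (a ∷ ys)))

    vsum-cong : ∀ n {f g : Vec (Fin p) n → ℤ} → (∀ y → f y ≡ g y) → vsum n f ≡ vsum n g
    vsum-cong zero e = e []
    vsum-cong (suc n) e = sum-cong-≗ (λ a → vsum-cong n (λ ys → e (a ∷ ys)))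

    vsum-distrib-+ : ∀ n (f g : Vec (Fin p) n → ℤ) → vsum n (λ y → f y + g y) ≡ vsum n f + vsum n g
    vsum-distrib-+ zero f g = refl
    vsum-distrib-+ (suc n) f g = trans (sum-cong-≗ (λ a → vsum-distrib-+ n (λ ys → f (a ∷ ys)) (λ ys → g (a ∷ ys))))
                                       (∑-distrib-+ (λ a → vsum n (λ ys → f (a ∷ ys))) (λ a → vsum n (λ ys → g (a ∷ ys))))

    vsum-*ˡ : ∀ n c (f : Vec (Fin p) n → ℤ) → vsum n (λ y → c * f y) ≡ c * vsum n f
    vsum-*ˡ zero c f = refl
    vsum-*ˡ (suc n) c f = trans (sum-cong-≗ (λ a → vsum-*ˡ n c (λ ys → f (a ∷ ys)))) (sum-*ˡ c (λ a → vsum n (λ ys → f (a ∷ ys))))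

    vsum-*ʳ : ∀ n c (g : Vec (Fin p) n → ℤ) → vsum n (λ y → g y * c) ≡ vsum n g * c
    vsum-*ʳ n c g = trans (vsum-cong n (λ y → ℤP.*-comm (g y) c)) (trans (vsum-*ˡ n c g) (ℤP.*-comm c (vsum n g)))

    vsum-sum-comm : ∀ n {m} (h : Fin m → Vec (Fin p) n → ℤ) → vsum n (λ y → sum (λ a → h a y)) ≡ sum (λ a → vsum n (h a))
    vsum-sum-comm zero h = refl
    vsum-sum-comm (suc n) h = trans (sum-cong-≗ (λ b → vsum-sum-comm n (λ a ys → h a (b ∷ ys))))
                                    (∑-comm (λ b a → vsum n (λ ys → h a (b ∷ ys))))

    vsum-comm : ∀ n n′ (g : Vec (Fin p) n → Vec (Fin p) n′ → ℤ) →
      vsum n (λ y → vsum n′ (λ z → g y z)) ≡ vsum n′ (λ z → vsum n (λ y → g y z))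
    vsum-comm zero n′ g = refl
    vsum-comm (suc n) n′ g = trans (sum-cong-≗ (λ a → vsum-comm n n′ (λ ys z → g (a ∷ ys) z)))
                                   (sym (vsum-sum-comm n′ (λ a z → vsum n (λ ys → g (a ∷ ys) z))))

    vsum-translate : ∀ n (g : Vec (Fin p) n → ℤ) (u : Vec (Fin p) n) → vsum n g ≡ vsum n (λ y → g (vadd y u))
    vsum-translate zero g [] = refl
    vsum-translate (suc n) g (c ∷ u) = begin
      sum (λ a → vsum n (λ ys → g (a ∷ ys)))                   ≡⟨ sum-translate _ c ⟩
      sum (λ a → vsum n (λ ys → g ((a +F c) ∷ ys)))            ≡⟨ sum-cong-≗ (λ a → vsum-translate n (λ ys → g ((a +F c) ∷ ys)) u) ⟩
      sum (λ a → vsum n (λ ys → g ((a +F c) ∷ vadd ys u)))     ∎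

    vsum-δ : ∀ n (c : Vec (Fin p) n) (g : Vec (Fin p) n → ℤ) → vsum n (λ z → ⟦ z ==V c ⟧ * g z) ≡ g c
    vsum-δ zero [] g = ℤP.*-identityˡ (g [])
    vsum-δ (suc n) (c ∷ cs) g = begin
      sum (λ a → vsum n (λ ys → ⟦ (a ∷ ys) ==V (c ∷ cs) ⟧ * g (a ∷ ys)))
        ≡⟨ sum-cong-≗ (λ a → vsum-cong n (λ ys → split a ys)) ⟩
      sum (λ a → vsum n (λ ys → ⟦ isYes (c F.≟ a) ⟧ * (⟦ ys ==V cs ⟧ * g (a ∷ ys))))
        ≡⟨ sum-cong-≗ (λ a → trans (vsum-*ˡ n ⟦ isYes (c F.≟ a) ⟧ _) (cong (⟦ isYes (c F.≟ a) ⟧ *_) (vsum-δ n cs (λ ys → g (a ∷ ys))))) ⟩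
      sum (λ a → ⟦ isYes (c F.≟ a) ⟧ * g (a ∷ cs))
        ≡⟨ sum-δ c (λ a → g (a ∷ cs)) ⟩
      g (c ∷ cs) ∎
      where
      split : ∀ a ys → ⟦ (a ∷ ys) ==V (c ∷ cs) ⟧ * g (a ∷ ys) ≡ ⟦ isYes (c F.≟ a) ⟧ * (⟦ ys ==V cs ⟧ * g (a ∷ ys))
      split a ys = begin
        ⟦ (a ∷ ys) ==V (c ∷ cs) ⟧ * g (a ∷ ys)                    ≡⟨ cong (λ b → ⟦ b ⟧ * g (a ∷ ys)) (==V-∷ a ys c cs) ⟩
        ⟦ isYes (c F.≟ a) ∧ (ys ==V cs) ⟧ * g (a ∷ ys)             ≡⟨ cong (_* g (a ∷ ys)) (⟦∧⟧ (isYes (c F.≟ a)) (ys ==V cs)) ⟩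
        ⟦ isYes (c F.≟ a) ⟧ * ⟦ ys ==V cs ⟧ * g (a ∷ ys)           ≡⟨ ℤP.*-assoc ⟦ isYes (c F.≟ a) ⟧ ⟦ ys ==V cs ⟧ (g (a ∷ ys)) ⟩
        ⟦ isYes (c F.≟ a) ⟧ * (⟦ ys ==V cs ⟧ * g (a ∷ ys))         ∎

    count≡vsum : ∀ n (P : Vec (Fin p) n → Bool) → + count P (allVecs n) ≡ vsum n (λ y → ⟦ P y ⟧)
    count≡vsum zero P with P []
    ... | true = refl
    ... | false = refl
    count≡vsum (suc n) P = begin
      + count P (concatMap (λ a → L.map (a ∷_) (allVecs n)) (tabulate id))
        ≡⟨ count-concatMap P id (λ a → L.map (a ∷_) (allVecs n)) ⟩
      sum (λ a → + count P (L.map (a ∷_) (allVecs n)))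
        ≡⟨ sum-cong-≗ (λ a → cong +_ (count-map P (a ∷_) (allVecs n))) ⟩
      sum (λ a → + count (λ ys → P (a ∷ ys)) (allVecs n))
        ≡⟨ sum-cong-≗ (λ a → count≡vsum n (λ ys → P (a ∷ ys))) ⟩
      vsum (suc n) (λ y → ⟦ P y ⟧) ∎

  -- The group ring ℤ[C_p] and ℤ[ζ]

  module GroupRing (p : ℕ) .{{_ : NonZero p}} where
    open GF p
    open ModularArithmetic p
    open VectorSums p using (sum-translate)

    ℤ[C] : Set
    ℤ[C] = Fin p → ℤ

    infixl 7 _⋆_
    _⋆_ : ℤ[C] → ℤ[C] → ℤ[C]
    (a ⋆ b) k = sum (λ j → a j * b (k ⊖ j))

    𝟘 : ℤ[C]
    𝟘 _ = + 0

    infixr 5 _·_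
    _·_ : ℤ → ℤ[C] → ℤ[C]
    (c · a) k = c * a k

    aug : ℤ[C] → ℤ
    aug = sum

    -- _≈ζ_ as a record, so that both sides can be inferred from a proof.
    infix 4 _≈_
    record _≈_ (a b : ℤ[C]) : Set where
      constructor ≈[_,_]
      field
        offset : ℤ
        a-b≡offset : ∀ k → a k - b k ≡ offset

    ≈⇒≈ζ : ∀ {a b} → a ≈ b → a ≈ζ b
    ≈⇒≈ζ ≈[ c , e ] = c , e

    ≈-sym : ∀ {a b} → a ≈ b → b ≈ a
    ≈-sym {a} {b} ≈[ c , e ] = ≈[ - c , (λ k → trans (lemma (a k) (b k)) (cong -_ (e k))) ]
      where lemma : ∀ x y → y - x ≡ - (x - y)
            lemma = solve-∀

    ≈-trans : ∀ {a b d} → a ≈ b → b ≈ d → a ≈ d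
    ≈-trans {a} {b} {d} ≈[ c , e ] ≈[ c′ , e′ ] =
      ≈[ c + c′ , (λ k → trans (lemma (a k) (b k) (d k)) (cong₂ _+_ (e k) (e′ k))) ]
      where lemma : ∀ x y z → x - z ≡ (x - y) + (y - z)
            lemma = solve-∀

    ≗⇒≈ : ∀ {a b} → a ≗ b → a ≈ b
    ≗⇒≈ {a} e = ≈[ + 0 , (λ k → trans (cong (λ z → a k - z) (sym (e k))) (ℤP.+-inverseʳ (a k))) ]

    ≈-respˡ-≗ : ∀ {a a′ b} → a ≗ a′ → a ≈ b → a′ ≈ b
    ≈-respˡ-≗ e h = ≈-trans (≗⇒≈ (sym ∘ e)) h

    ≈𝟘⇒const : ∀ {a} → a ≈ 𝟘 → ∀ k → a k ≡ a 0F
    ≈𝟘⇒const {a} ≈[ c , e ] k = trans (sym (ℤP.+-identityʳ (a k))) (trans (e k) (sym (trans (sym (ℤP.+-identityʳ (a 0F))) (e 0F))))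

    const⇒≈𝟘 : ∀ {a} c → (∀ k → a k ≡ c) → a ≈ 𝟘
    const⇒≈𝟘 {a} c e = ≈[ c , (λ k → trans (ℤP.+-identityʳ (a k)) (e k)) ]

    sum-reflect : ∀ (b : ℤ[C]) k → sum (λ j → b (k ⊖ j)) ≡ aug b
    sum-reflect b k = sym (sum-reindex b (k ⊖_) (k ⊖_) (a⊖[a⊖b]≡b k) (a⊖[a⊖b]≡b k))

    ⋆-comm : ∀ a b → a ⋆ b ≗ b ⋆ a
    ⋆-comm a b k = begin
      sum (λ j → a j * b (k ⊖ j))
        ≡⟨ sum-reindex (λ j → a j * b (k ⊖ j)) (k ⊖_) (k ⊖_) (a⊖[a⊖b]≡b k) (a⊖[a⊖b]≡b k) ⟩
      sum (λ j → a (k ⊖ j) * b (k ⊖ (k ⊖ j)))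
        ≡⟨ sum-cong-≗ (λ j → trans (cong (λ z → a (k ⊖ j) * b z) (a⊖[a⊖b]≡b k j)) (ℤP.*-comm (a (k ⊖ j)) (b j))) ⟩
      sum (λ j → b j * a (k ⊖ j)) ∎

    ⋆-assoc : ∀ a b c → (a ⋆ b) ⋆ c ≗ a ⋆ (b ⋆ c)
    ⋆-assoc a b c k = begin
      sum (λ j → sum (λ l → a l * b (j ⊖ l)) * c (k ⊖ j))
        ≡⟨ sum-cong-≗ (λ j → sum-*ʳ (c (k ⊖ j)) (λ l → a l * b (j ⊖ l))) ⟨
      sum (λ j → sum (λ l → a l * b (j ⊖ l) * c (k ⊖ j)))
        ≡⟨ ∑-comm (λ j l → a l * b (j ⊖ l) * c (k ⊖ j)) ⟩
      sum (λ l → sum (λ j → a l * b (j ⊖ l) * c (k ⊖ j)))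
        ≡⟨ sum-cong-≗ (λ l → trans (sum-cong-≗ (λ j → ℤP.*-assoc (a l) (b (j ⊖ l)) (c (k ⊖ j))))
                                   (sum-*ˡ (a l) (λ j → b (j ⊖ l) * c (k ⊖ j)))) ⟩
      sum (λ l → a l * sum (λ j → b (j ⊖ l) * c (k ⊖ j)))
        ≡⟨ sum-cong-≗ (λ l → cong (a l *_) (shift l)) ⟩
      sum (λ l → a l * (b ⋆ c) (k ⊖ l)) ∎
      where
      shift : ∀ l → sum (λ j → b (j ⊖ l) * c (k ⊖ j)) ≡ (b ⋆ c) (k ⊖ l)
      shift l = trans (sum-translate (λ j → b (j ⊖ l) * c (k ⊖ j)) l)
                      (sum-cong-≗ (λ i → cong₂ _*_ (cong b ([a+b]⊖b≡a i l)) (cong c (a⊖[b+c]≡[a⊖c]⊖b k i l))))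

    ⋆-cong-≗ˡ : ∀ {a a′} b → a ≗ a′ → a ⋆ b ≗ a′ ⋆ b
    ⋆-cong-≗ˡ b e k = sum-cong-≗ (λ j → cong (_* b (_ ⊖ j)) (e j))

    ⋆-congˡ : ∀ {a a′} b → a ≈ a′ → a ⋆ b ≈ a′ ⋆ b
    ⋆-congˡ {a} {a′} b ≈[ c , e ] = ≈[ c * aug b , (λ k → begin
      sum (λ j → a j * b (k ⊖ j)) - sum (λ j → a′ j * b (k ⊖ j))
        ≡⟨ sum-distrib-sub (λ j → a j * b (k ⊖ j)) (λ j → a′ j * b (k ⊖ j)) ⟨
      sum (λ j → a j * b (k ⊖ j) - a′ j * b (k ⊖ j))
        ≡⟨ sum-cong-≗ (λ j → trans (factor (a j) (a′ j) (b (k ⊖ j))) (cong (_* b (k ⊖ j)) (e j))) ⟩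
      sum (λ j → c * b (k ⊖ j))  ≡⟨ sum-*ˡ c (λ j → b (k ⊖ j)) ⟩
      c * sum (λ j → b (k ⊖ j))  ≡⟨ cong (c *_) (sum-reflect b k) ⟩
      c * aug b                   ∎) ]
      where factor : ∀ x y z → x * z - y * z ≡ (x - y) * z
            factor = solve-∀

    ⋆-congʳ : ∀ a {b b′} → b ≈ b′ → a ⋆ b ≈ a ⋆ b′
    ⋆-congʳ a {b} {b′} e = ≈-trans (≗⇒≈ (⋆-comm a b)) (≈-trans (⋆-congˡ a e) (≗⇒≈ (⋆-comm b′ a)))

    ·-⋆ : ∀ c a b → (c · a) ⋆ b ≗ c · (a ⋆ b)
    ·-⋆ c a b k = trans (sum-cong-≗ (λ j → ℤP.*-assoc c (a j) (b (k ⊖ j)))) (sum-*ˡ c (λ j → a j * b (k ⊖ j)))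

    ·-≈𝟘 : ∀ c {x} → x ≈ 𝟘 → c · x ≈ 𝟘
    ·-≈𝟘 c {x} h = const⇒≈𝟘 (c * x 0F) (λ k → cong (c *_) (≈𝟘⇒const h k))

    aug-⋆ : ∀ a b → aug (a ⋆ b) ≡ aug a * aug b
    aug-⋆ a b = begin
      sum (λ k → sum (λ j → a j * b (k ⊖ j)))  ≡⟨ ∑-comm (λ k j → a j * b (k ⊖ j)) ⟩
      sum (λ j → sum (λ k → a j * b (k ⊖ j)))  ≡⟨ sum-cong-≗ (λ j → sum-*ˡ (a j) (λ k → b (k ⊖ j))) ⟩
      sum (λ j → a j * sum (λ k → b (k ⊖ j)))  ≡⟨ sum-cong-≗ (λ j → cong (a j *_) (sym (sum-translate b (-F j)))) ⟩
      sum (λ j → a j * aug b)                   ≡⟨ sum-*ʳ (aug b) a ⟩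
      aug a * aug b                             ∎

    ≈𝟘⇒p∣aug : ∀ {c} → c ≈ 𝟘 → + p ∣ aug c
    ≈𝟘⇒p∣aug {c} h = divides (c 0F) (begin
      aug c             ≡⟨ sum-cong-≗ (≈𝟘⇒const h) ⟩
      sum {p} (λ _ → c 0F)  ≡⟨ sum-const p (c 0F) ⟩
      + p * c 0F        ≡⟨ ℤP.*-comm (+ p) (c 0F) ⟩
      c 0F * + p        ∎)

    δ : Fin p → ℤ[C]
    δ c j = ⟦ isYes (c F.≟ j) ⟧

    δ-⋆ : ∀ c a k → (δ c ⋆ a) k ≡ a (k ⊖ c)
    δ-⋆ c a k = sum-δ c (λ j → a (k ⊖ j))

    δ0-⋆ : ∀ a → δ 0F ⋆ a ≗ a
    δ0-⋆ a k = trans (δ-⋆ 0F a k) (cong a (a⊖0≡a k))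

    intζ≗·δ0 : ∀ z → intζ z ≗ z · δ 0F
    intζ≗·δ0 z k with toℕ k in eq
    ... | zero  = begin
      z                   ≡⟨ ℤP.*-identityʳ z ⟨
      z * + 1             ≡⟨ cong (λ b → z * ⟦ b ⟧) (isYes≡true (0F F.≟ k) 0F≡k) ⟨
      z * δ 0F k          ∎
      where 0F≡k = FP.toℕ-injective (trans toℕ-0F (sym eq))
    ... | suc t = begin
      + 0                 ≡⟨ ℤP.*-zeroʳ z ⟨
      z * + 0             ≡⟨ cong (λ b → z * ⟦ b ⟧) (isYes≡false (0F F.≟ k) 0F≢k) ⟨
      z * δ 0F k          ∎
      where 0F≢k = λ e → ℕP.0≢1+n (trans (sym toℕ-0F) (trans (cong toℕ e) eq))

    _⊕_ : ℤ[C] → ℤ → ℤ[C]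
    (b ⊕ α) k = b k + α * δ 0F k

    ⊕-⋆-⊕ : ∀ b α β k → ((b ⊕ α) ⋆ (b ⊕ β)) k ≡ (b ⋆ b) k + (α + β) * b k + α * β * δ 0F k
    ⊕-⋆-⊕ b α β k = begin
      sum (λ j → (b j + α * e j) * (b (k ⊖ j) + β * e (k ⊖ j)))
        ≡⟨ sum-cong-≗ (λ j → expand (b j) α (e j) (b (k ⊖ j)) β (e (k ⊖ j))) ⟩
      sum (λ j → (bb j + β * be j) + (α * eb j + α * β * ee j))
        ≡⟨ ∑-distrib-+ (λ j → bb j + β * be j) (λ j → α * eb j + α * β * ee j) ⟩
      sum (λ j → bb j + β * be j) + sum (λ j → α * eb j + α * β * ee j)
        ≡⟨ cong₂ _+_ (∑-distrib-+ bb (λ j → β * be j)) (∑-distrib-+ (λ j → α * eb j) (λ j → α * β * ee j)) ⟩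
      (sum bb + sum (λ j → β * be j)) + (sum (λ j → α * eb j) + sum (λ j → α * β * ee j))
        ≡⟨ cong₂ (λ u v → (sum bb + u) + v) (sum-*ˡ β be) (cong₂ _+_ (sum-*ˡ α eb) (sum-*ˡ (α * β) ee)) ⟩
      ((b ⋆ b) k + β * (b ⋆ e) k) + (α * (e ⋆ b) k + α * β * (e ⋆ e) k)
        ≡⟨ cong₂ (λ u v → ((b ⋆ b) k + β * u) + v) (trans (⋆-comm b e k) (δ0-⋆ b k)) (cong₂ (λ u v → α * u + α * β * v) (δ0-⋆ b k) (δ0-⋆ e k)) ⟩
      ((b ⋆ b) k + β * b k) + (α * b k + α * β * e k)
        ≡⟨ collect ((b ⋆ b) k) (b k) (e k) α β ⟩
      (b ⋆ b) k + (α + β) * b k + α * β * e k ∎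
      where
      e : ℤ[C]
      e = δ 0F
      bb be eb ee : Fin p → ℤ
      bb j = b j * b (k ⊖ j)
      be j = b j * e (k ⊖ j)
      eb j = e j * b (k ⊖ j)
      ee j = e j * e (k ⊖ j)
      expand : ∀ x α e y β e′ → (x + α * e) * (y + β * e′) ≡ (x * y + β * (x * e′)) + (α * (e * y) + α * β * (e * e′))
      expand = solve-∀
      collect : ∀ S B E α β → (S + β * B) + (α * B + α * β * E) ≡ S + (α + β) * B + α * β * E
      collect = solve-∀

    ⊕-≈𝟘⇒≈intζ : ∀ b z → b ⊕ (- z) ≈ 𝟘 → b ≈ζ intζ z
    ⊕-≈𝟘⇒≈intζ b z ≈[ c , e ] = c , λ k → begin
      b k - intζ z k             ≡⟨ cong (λ u → b k - u) (intζ≗·δ0 z k) ⟩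
      b k - z * δ 0F k           ≡⟨ rewrite-neg (b k) z (δ 0F k) ⟩
      b k + - z * δ 0F k - + 0   ≡⟨ e k ⟩
      c                          ∎
      where rewrite-neg : ∀ b z d → b - z * d ≡ b + - z * d - + 0
            rewrite-neg = solve-∀

    ≈𝟘? : ∀ a → Dec (a ≈ 𝟘)
    ≈𝟘? a with FP.all? (λ k → a k ℤ.≟ a 0F)
    ... | yes h = yes (const⇒≈𝟘 (a 0F) h)
    ... | no ¬h = no (¬h ∘ ≈𝟘⇒const)

  -- Divisibility by π = 1 - ζ

  sumUpTo : ℕ → (ℕ → ℤ) → ℤ
  sumUpTo zero h = + 0
  sumUpTo (suc n) h = sumUpTo n h + h n

  sumUpTo-cons : ∀ n h → sumUpTo (suc n) h ≡ h 0 + sumUpTo n (h ∘ suc)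
  sumUpTo-cons zero h = trans (ℤP.+-identityˡ (h 0)) (sym (ℤP.+-identityʳ (h 0)))
  sumUpTo-cons (suc n) h = begin
    sumUpTo (suc n) h + h (suc n)             ≡⟨ cong (_+ h (suc n)) (sumUpTo-cons n h) ⟩
    h 0 + sumUpTo n (h ∘ suc) + h (suc n)     ≡⟨ ℤP.+-assoc (h 0) _ _ ⟩
    h 0 + sumUpTo (suc n) (h ∘ suc)           ∎

  sum≡sumUpTo : ∀ n (h : ℕ → ℤ) → sum {n} (h ∘ toℕ) ≡ sumUpTo n h
  sum≡sumUpTo zero h = refl
  sum≡sumUpTo (suc n) h = trans (cong (λ z → h 0 + z) (sum≡sumUpTo n (h ∘ suc))) (sym (sumUpTo-cons n h))

  sumUpTo-minus-const : ∀ n h s → sumUpTo n (λ t → h t - s) ≡ sumUpTo n h - + n * s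
  sumUpTo-minus-const zero h s = refl
  sumUpTo-minus-const (suc n) h s = begin
    sumUpTo n (λ t → h t - s) + (h n - s)     ≡⟨ cong (_+ (h n - s)) (sumUpTo-minus-const n h s) ⟩
    sumUpTo n h - + n * s + (h n - s)         ≡⟨ regroup (sumUpTo n h) (+ n) s (h n) ⟩
    sumUpTo n h + h n - (+ 1 + + n) * s       ≡⟨ cong (λ z → sumUpTo n h + h n - z * s) (ℤP.pos-+ 1 n) ⟨
    sumUpTo n h + h n - + suc n * s           ∎
    where regroup : ∀ a n s b → a - n * s + (b - s) ≡ a + b - (+ 1 + n) * s
          regroup = solve-∀

  arithmetic-progression : ∀ (g : ℕ → ℤ) s → (∀ t → g (suc t) ≡ g t + s) → ∀ t → g t ≡ g 0 + + t * s
  arithmetic-progression g s step zero = sym (trans (cong (λ z → g 0 + z) (ℤP.*-zeroˡ s)) (ℤP.+-identityʳ (g 0)))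
  arithmetic-progression g s step (suc t) = begin
    g (suc t)               ≡⟨ step t ⟩
    g t + s                 ≡⟨ cong (_+ s) (arithmetic-progression g s step t) ⟩
    g 0 + + t * s + s       ≡⟨ regroup (g 0) (+ t) s ⟩
    g 0 + (+ 1 + + t) * s   ≡⟨ cong (λ z → g 0 + z * s) (ℤP.pos-+ 1 t) ⟨
    g 0 + + suc t * s       ∎
    where regroup : ∀ a t s → a + t * s + s ≡ a + (+ 1 + t) * s
          regroup = solve-∀

  module Cyclotomic (q : ℕ) (1≤q : 1 ≤ q) where
    open GF (suc q)
    open ModularArithmetic (suc q)
    open GroupRing (suc q)

    toℕ-1F : toℕ 1F ≡ 1
    toℕ-1F = trans (toℕ-ofℕ 1) (m<n⇒m%n≡m (s≤s 1≤q))

    ofℕ-suc⊖1F : ∀ t → ofℕ (suc t) ⊖ 1F ≡ ofℕ t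
    ofℕ-suc⊖1F t = sym (a+b≡c⇒a≡c⊖b (begin
      ofℕ (toℕ (ofℕ t) ℕ.+ toℕ (ofℕ 1))  ≡⟨ ofℕ-absorbˡ-+ t (toℕ (ofℕ 1)) ⟩
      ofℕ (t ℕ.+ toℕ (ofℕ 1))            ≡⟨ ofℕ-absorbʳ-+ t 1 ⟩
      ofℕ (t ℕ.+ 1)                      ≡⟨ cong ofℕ (ℕP.+-comm t 1) ⟩
      ofℕ (suc t)                        ∎))

    ofℕ-[1+q] : ofℕ (suc q) ≡ 0F
    ofℕ-[1+q] = ofℕ-cong-% {suc q} {0} (n%n≡0 (suc q))

    toℕ≡⇒≡ofℕ : ∀ (k : Fin (suc q)) {t} → toℕ k ≡ t → k ≡ ofℕ t
    toℕ≡⇒≡ofℕ k e = trans (sym (ofℕ-toℕ k)) (cong ofℕ e)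

    toℕ-⊖1F-suc : ∀ k t → toℕ k ≡ suc t → toℕ (k ⊖ 1F) ≡ t
    toℕ-⊖1F-suc k t e = begin
      toℕ (k ⊖ 1F)             ≡⟨ cong (λ z → toℕ (z ⊖ 1F)) (toℕ≡⇒≡ofℕ k e) ⟩
      toℕ (ofℕ (suc t) ⊖ 1F)   ≡⟨ cong toℕ (ofℕ-suc⊖1F t) ⟩
      toℕ (ofℕ t)              ≡⟨ toℕ-ofℕ t ⟩
      t % suc q                ≡⟨ m<n⇒m%n≡m (ℕP.<-trans (ℕP.n<1+n t) (subst (_< suc q) e (FP.toℕ<n k))) ⟩
      t                        ∎

    toℕ-⊖1F-zero : ∀ k → toℕ k ≡ 0 → toℕ (k ⊖ 1F) ≡ q
    toℕ-⊖1F-zero k e = begin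
      toℕ (k ⊖ 1F)                ≡⟨ cong (λ z → toℕ (z ⊖ 1F)) (toℕ≡⇒≡ofℕ k e) ⟩
      toℕ (0F ⊖ 1F)               ≡⟨ cong toℕ (+F-identityˡ (-F 1F)) ⟩
      toℕ (ofℕ (suc q ∸ toℕ 1F))  ≡⟨ cong (λ z → toℕ (ofℕ (suc q ∸ z))) toℕ-1F ⟩
      toℕ (ofℕ q)                 ≡⟨ toℕ-ofℕ q ⟩
      q % suc q                   ≡⟨ m<n⇒m%n≡m (ℕP.n<1+n q) ⟩
      q                           ∎

    π : ℤ[C]
    π k = δ 0F k - δ 1F k

    toℤ : ℤ[C] → ℤ
    toℤ b = b 0F - b 1F

    toℤ-cong : ∀ b c → b ≈ζ c → toℤ b ≡ toℤ c
    toℤ-cong b c (s , e) = begin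
      b 0F - b 1F                                ≡⟨ regroup (b 0F) (b 1F) (c 0F) (c 1F) ⟩
      c 0F - c 1F + ((b 0F - c 0F) - (b 1F - c 1F))  ≡⟨ cong₂ (λ u v → c 0F - c 1F + (u - v)) (e 0F) (e 1F) ⟩
      c 0F - c 1F + (s - s)                      ≡⟨ cong (λ z → c 0F - c 1F + z) (ℤP.+-inverseʳ s) ⟩
      c 0F - c 1F + + 0                          ≡⟨ ℤP.+-identityʳ _ ⟩
      c 0F - c 1F                                ∎
      where regroup : ∀ b0 b1 c0 c1 → b0 - b1 ≡ c0 - c1 + ((b0 - c0) - (b1 - c1))
            regroup = solve-∀

    toℤ-intζ : ∀ z → toℤ (intζ z) ≡ z
    toℤ-intζ z = begin
      intζ z 0F - intζ z 1F                                          ≡⟨ cong₂ (λ u v → (if u ℕ.≡ᵇ 0 then z else + 0) - (if v ℕ.≡ᵇ 0 then z else + 0)) toℕ-0F toℕ-1F ⟩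
      z - + 0                                                        ≡⟨ ℤP.+-identityʳ z ⟩
      z                                                              ∎

    toℤ-δ0 : toℤ (δ 0F) ≡ + 1
    toℤ-δ0 = trans (toℤ-cong (δ 0F) (intζ (+ 1)) (≈⇒≈ζ (≗⇒≈ λ k → sym (trans (intζ≗·δ0 (+ 1) k) (ℤP.*-identityˡ (δ 0F k)))))) (toℤ-intζ (+ 1))

    toℤ-sum : ∀ {m} (b : Fin m → ℤ[C]) → toℤ (λ k → sum (λ t → b t k)) ≡ sum (λ t → toℤ (b t))
    toℤ-sum b = sym (sum-distrib-sub (λ t → b t 0F) (λ t → b t 1F))


    π-⋆ : ∀ c k → (π ⋆ c) k ≡ c k - c (k ⊖ 1F)
    π-⋆ c k = begin
      sum (λ j → (δ 0F j - δ 1F j) * c (k ⊖ j))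
        ≡⟨ sum-cong-≗ (λ j → distrib (δ 0F j) (δ 1F j) (c (k ⊖ j))) ⟩
      sum (λ j → δ 0F j * c (k ⊖ j) - δ 1F j * c (k ⊖ j))
        ≡⟨ sum-distrib-sub (λ j → δ 0F j * c (k ⊖ j)) (λ j → δ 1F j * c (k ⊖ j)) ⟩
      (δ 0F ⋆ c) k - (δ 1F ⋆ c) k
        ≡⟨ cong₂ _-_ (δ0-⋆ c k) (δ-⋆ 1F c k) ⟩
      c k - c (k ⊖ 1F) ∎
      where distrib : ∀ x y z → (x - y) * z ≡ x * z - y * z
            distrib = solve-∀

    -- If c k - c (k - 1) is a constant s, then c (ofℕ t) = c 0 + t s; going once around the
    -- cycle forces p s = 0.
    π⋆-injective : ∀ c → π ⋆ c ≈ 𝟘 → c ≈ 𝟘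
    π⋆-injective c ≈[ s , e ] = const⇒≈𝟘 (g 0) (λ k → trans (cong c (toℕ≡⇒≡ofℕ k refl)) (g-const (toℕ k)))
      where
      g : ℕ → ℤ
      g t = c (ofℕ t)
      increment : ∀ k → c k - c (k ⊖ 1F) ≡ s
      increment k = trans (sym (π-⋆ c k)) (trans (sym (ℤP.+-identityʳ ((π ⋆ c) k))) (e k))
      step : ∀ t → g (suc t) ≡ g t + s
      step t = begin
        g (suc t)                        ≡⟨ cancel (g (suc t)) (g t) ⟨
        g (suc t) - g t + g t            ≡⟨ cong (λ z → g (suc t) - c z + g t) (ofℕ-suc⊖1F t) ⟨
        g (suc t) - c (ofℕ (suc t) ⊖ 1F) + g t  ≡⟨ cong (_+ g t) (increment (ofℕ (suc t))) ⟩
        s + g t                          ≡⟨ ℤP.+-comm s (g t) ⟩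
        g t + s                          ∎
        where cancel : ∀ x y → x - y + y ≡ x
              cancel = solve-∀
      progression : ∀ t → g t ≡ g 0 + + t * s
      progression = arithmetic-progression g s step
      ps≡0 : + suc q * s ≡ + 0
      ps≡0 = +-cancelˡ (g 0) (+ suc q * s) (+ 0) (begin
        g 0 + + suc q * s  ≡⟨ progression (suc q) ⟨
        g (suc q)          ≡⟨ cong c ofℕ-[1+q] ⟩
        g 0                ≡⟨ ℤP.+-identityʳ (g 0) ⟨
        g 0 + + 0          ∎)
      s≡0 : s ≡ + 0
      s≡0 = [ (λ ()) , id ]′ (ℤP.i*j≡0⇒i≡0∨j≡0 (+ suc q) ps≡0)
      g-const : ∀ t → g t ≡ g 0
      g-const t = begin
        g t                ≡⟨ progression t ⟩
        g 0 + + t * s      ≡⟨ cong (λ z → g 0 + + t * z) s≡0 ⟩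
        g 0 + + t * + 0    ≡⟨ cong (λ z → g 0 + z) (ℤP.*-zeroʳ (+ t)) ⟩
        g 0 + + 0          ≡⟨ ℤP.+-identityʳ (g 0) ⟩
        g 0                ∎

    -- The witness is the sequence of partial sums of a - s, which closes up since aug a = p s.
    p∣aug⇒π∣ : ∀ a → + suc q ∣ aug a → ∃ λ c → a ≈ π ⋆ c
    p∣aug⇒π∣ a (divides s aug≡sp) = c , ≈[ s , (λ k → trans (cong (λ z → a k - z) (π-⋆ c k)) (difference k (toℕ k) refl)) ]
      where
      g : ℕ → ℤ
      g t = a (ofℕ t) - s
      c : ℤ[C]
      c k = sumUpTo (suc (toℕ k)) g
      total : sumUpTo (suc q) g ≡ + 0
      total = begin
        sumUpTo (suc q) g                    ≡⟨ sumUpTo-minus-const (suc q) (a ∘ ofℕ) s ⟩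
        sumUpTo (suc q) (a ∘ ofℕ) - + suc q * s
          ≡⟨ cong (_- + suc q * s) (sum≡sumUpTo (suc q) (a ∘ ofℕ)) ⟨
        sum {suc q} (a ∘ ofℕ ∘ toℕ) - + suc q * s  ≡⟨ cong (_- + suc q * s) (sum-cong-≗ (cong a ∘ ofℕ-toℕ)) ⟩
        aug a - + suc q * s                  ≡⟨ cong (_- + suc q * s) (trans aug≡sp (ℤP.*-comm s (+ suc q))) ⟩
        + suc q * s - + suc q * s            ≡⟨ ℤP.+-inverseʳ (+ suc q * s) ⟩
        + 0                                  ∎
      difference : ∀ k t → toℕ k ≡ t → a k - (c k - c (k ⊖ 1F)) ≡ s
      difference k zero e = begin
        a k - (sumUpTo (suc (toℕ k)) g - sumUpTo (suc (toℕ (k ⊖ 1F))) g)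
          ≡⟨ cong₂ (λ u v → a k - (sumUpTo (suc u) g - sumUpTo (suc v) g)) e (toℕ-⊖1F-zero k e) ⟩
        a k - ((+ 0 + (a (ofℕ 0) - s)) - sumUpTo (suc q) g)
          ≡⟨ cong₂ (λ u v → a k - ((+ 0 + (a u - s)) - v)) (sym (toℕ≡⇒≡ofℕ k e)) total ⟩
        a k - ((+ 0 + (a k - s)) - + 0)
          ≡⟨ cancel (a k) s ⟩
        s ∎
        where cancel : ∀ x s → x - ((+ 0 + (x - s)) - + 0) ≡ s
              cancel = solve-∀
      difference k (suc t) e = begin
        a k - (sumUpTo (suc (toℕ k)) g - sumUpTo (suc (toℕ (k ⊖ 1F))) g)
          ≡⟨ cong₂ (λ u v → a k - (sumUpTo (suc u) g - sumUpTo (suc v) g)) e (toℕ-⊖1F-suc k t e) ⟩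
        a k - ((sumUpTo (suc t) g + (a (ofℕ (suc t)) - s)) - sumUpTo (suc t) g)
          ≡⟨ cong (λ z → a k - ((sumUpTo (suc t) g + (a z - s)) - sumUpTo (suc t) g)) (sym (toℕ≡⇒≡ofℕ k e)) ⟩
        a k - ((sumUpTo (suc t) g + (a k - s)) - sumUpTo (suc t) g)
          ≡⟨ cancel (a k) s (sumUpTo (suc t) g) ⟩
        s ∎
        where cancel : ∀ x s y → x - ((y + (x - s)) - y) ≡ s
              cancel = solve-∀

  -- ℤ[ζ] has no zero divisors

  neg1^ : ℕ → ℤ
  neg1^ zero = + 1
  neg1^ (suc t) = - neg1^ t

  [1+k]*[1+n]C[1+k]≡[1+n]*nCk : ∀ n k → suc k ℕ.* (suc n C suc k) ≡ suc n ℕ.* (n C k)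
  [1+k]*[1+n]C[1+k]≡[1+n]*nCk zero zero = refl
  [1+k]*[1+n]C[1+k]≡[1+n]*nCk zero (suc k) = ℕP.*-zeroʳ (suc (suc k))
  [1+k]*[1+n]C[1+k]≡[1+n]*nCk (suc n) zero = begin
    1 ℕ.* (suc (suc n) C 1)  ≡⟨ ℕP.*-identityˡ _ ⟩
    suc (suc n) C 1          ≡⟨ nC1≡n (suc (suc n)) ⟩
    suc (suc n)              ≡⟨ ℕP.*-identityʳ _ ⟨
    suc (suc n) ℕ.* 1        ∎
  [1+k]*[1+n]C[1+k]≡[1+n]*nCk (suc n) (suc k) = begin
    suc (suc k) ℕ.* (suc (suc n) C suc (suc k))
      ≡⟨ cong (suc (suc k) ℕ.*_) (nCk+nC[k+1]≡[n+1]C[k+1] (suc n) (suc k)) ⟨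
    suc (suc k) ℕ.* (X ℕ.+ suc n C suc (suc k))
      ≡⟨ ℕP.*-distribˡ-+ (suc (suc k)) X _ ⟩
    (X ℕ.+ suc k ℕ.* X) ℕ.+ suc (suc k) ℕ.* (suc n C suc (suc k))
      ≡⟨ cong₂ (λ u v → (X ℕ.+ u) ℕ.+ v) ([1+k]*[1+n]C[1+k]≡[1+n]*nCk n k) ([1+k]*[1+n]C[1+k]≡[1+n]*nCk n (suc k)) ⟩
    (X ℕ.+ suc n ℕ.* (n C k)) ℕ.+ suc n ℕ.* (n C suc k)
      ≡⟨ ℕP.+-assoc X _ _ ⟩
    X ℕ.+ (suc n ℕ.* (n C k) ℕ.+ suc n ℕ.* (n C suc k))
      ≡⟨ cong (X ℕ.+_) (ℕP.*-distribˡ-+ (suc n) (n C k) _) ⟨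
    X ℕ.+ suc n ℕ.* (n C k ℕ.+ n C suc k)
      ≡⟨ cong (λ z → X ℕ.+ suc n ℕ.* z) (nCk+nC[k+1]≡[n+1]C[k+1] n k) ⟩
    X ℕ.+ suc n ℕ.* X ∎
    where
    X : ℕ
    X = suc n C suc k

  ℤ-euclidsLemma : ∀ {p} → Prime p → ∀ x y → + p ∣ x * y → + p ∣ x ⊎ + p ∣ y
  ℤ-euclidsLemma {p} p-prime x y p∣xy with euclidsLemma ℤ.∣ x ∣ ℤ.∣ y ∣ p-prime (ℕ∣.∣-trans (∣⇒∣ᵤ p∣xy) (ℕ∣.∣-reflexive (ℤP.abs-* x y)))
  ... | inj₁ p∣x = inj₁ (∣ᵤ⇒∣ p∣x)
  ... | inj₂ p∣y = inj₂ (∣ᵤ⇒∣ p∣y)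

  prime[1+q]⇒1≤q : ∀ {q} → Prime (suc q) → 1 ≤ q
  prime[1+q]⇒1≤q {q} p-prime = ℕP.≤-pred (ℕ.nonTrivial⇒n>1 (suc q) {{prime⇒nonTrivial p-prime}})

  ℕsum≡0⇒≡0 : ∀ {n} (f : Fin n → ℕ) → ℕΣ.sum f ≡ 0 → ∀ k → f k ≡ 0
  ℕsum≡0⇒≡0 {suc n} f e F.zero = ℕP.m+n≡0⇒m≡0 (f F.zero) e
  ℕsum≡0⇒≡0 {suc n} f e (F.suc k) = ℕsum≡0⇒≡0 (f ∘ F.suc) (ℕP.m+n≡0⇒n≡0 (f F.zero) e) k

  module PowersOfπ (q : ℕ) (p-prime : Prime (suc q)) where
    1≤q : 1 ≤ q
    1≤q = prime[1+q]⇒1≤q p-prime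

    open GF (suc q)
    open ModularArithmetic (suc q)
    open GroupRing (suc q)
    open Cyclotomic q 1≤q

    π^ : ℕ → ℤ[C]
    π^ zero = δ 0F
    π^ (suc j) = π ⋆ π^ j

    π^-coefficient : ∀ j → j ≤ q → ∀ k → π^ j k ≡ neg1^ (toℕ k) * + (j C toℕ k)
    π^-coefficient zero _ k with toℕ k in eq
    ... | zero  = cong ⟦_⟧ (isYes≡true (0F F.≟ k) (FP.toℕ-injective (trans toℕ-0F (sym eq))))
    ... | suc t = trans (cong ⟦_⟧ (isYes≡false (0F F.≟ k) (λ e → ℕP.0≢1+n (trans (sym toℕ-0F) (trans (cong toℕ e) eq)))))
                        (sym (ℤP.*-zeroʳ (neg1^ (suc t))))
    π^-coefficient (suc j) 1+j≤q k =
      trans (π-⋆ (π^ j) k) (trans (cong₂ _-_ (IH k) (IH (k ⊖ 1F))) (pascal (toℕ k) refl))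
      where
      IH : ∀ k → π^ j k ≡ neg1^ (toℕ k) * + (j C toℕ k)
      IH = π^-coefficient j (ℕP.<⇒≤ 1+j≤q)
      pascal : ∀ t → toℕ k ≡ t →
        neg1^ (toℕ k) * + (j C toℕ k) - neg1^ (toℕ (k ⊖ 1F)) * + (j C toℕ (k ⊖ 1F)) ≡ neg1^ (toℕ k) * + (suc j C toℕ k)
      pascal zero e = begin
        neg1^ (toℕ k) * + (j C toℕ k) - neg1^ (toℕ (k ⊖ 1F)) * + (j C toℕ (k ⊖ 1F))
          ≡⟨ cong₂ (λ u v → neg1^ u * + (j C u) - neg1^ v * + (j C v)) e (toℕ-⊖1F-zero k e) ⟩
        + 1 * + 1 - neg1^ q * + (j C q)  ≡⟨ cong (λ z → + 1 * + 1 - neg1^ q * + z) (k>n⇒nCk≡0 1+j≤q) ⟩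
        + 1 * + 1 - neg1^ q * + 0        ≡⟨ simplify (neg1^ q) ⟩
        + 1                              ≡⟨ cong (λ u → neg1^ u * + (suc j C u)) e ⟨
        neg1^ (toℕ k) * + (suc j C toℕ k) ∎
        where simplify : ∀ x → + 1 * + 1 - x * + 0 ≡ + 1
              simplify = solve-∀
      pascal (suc t) e = begin
        neg1^ (toℕ k) * + (j C toℕ k) - neg1^ (toℕ (k ⊖ 1F)) * + (j C toℕ (k ⊖ 1F))
          ≡⟨ cong₂ (λ u v → neg1^ u * + (j C u) - neg1^ v * + (j C v)) e (toℕ-⊖1F-suc k t e) ⟩
        - neg1^ t * + (j C suc t) - neg1^ t * + (j C t)  ≡⟨ collect (neg1^ t) (+ (j C t)) (+ (j C suc t)) ⟩
        - neg1^ t * (+ (j C t) + + (j C suc t))          ≡⟨ cong (λ z → - neg1^ t * z) (ℤP.pos-+ (j C t) _) ⟨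
        - neg1^ t * + (j C t ℕ.+ j C suc t)              ≡⟨ cong (λ z → - neg1^ t * + z) (nCk+nC[k+1]≡[n+1]C[k+1] j t) ⟩
        - neg1^ t * + (suc j C suc t)                    ≡⟨ cong (λ u → neg1^ u * + (suc j C u)) e ⟨
        neg1^ (toℕ k) * + (suc j C toℕ k)                ∎
        where collect : ∀ x a b → - x * b - x * a ≡ - x * (a + b)
              collect = solve-∀

    p∣pC[1+t] : ∀ t → suc t ≤ q → suc q ℕ∣.∣ (suc q C suc t)
    p∣pC[1+t] t 1+t≤q with euclidsLemma (suc t) (suc q C suc t) p-prime
      (ℕ∣.divides (q C t) (trans ([1+k]*[1+n]C[1+k]≡[1+n]*nCk q t) (ℕP.*-comm (suc q) (q C t))))
    ... | inj₁ p∣1+t = ⊥-elim (ℕP.<⇒≱ (s≤s 1+t≤q) (ℕ∣.∣⇒≤ p∣1+t))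
    ... | inj₂ p∣C = p∣C

    p∣neg1^t*qCt-1 : ∀ t → t ≤ q → + suc q ∣ neg1^ t * + (q C t) - + 1
    p∣neg1^t*qCt-1 zero _ = divides (+ 0) refl
    p∣neg1^t*qCt-1 (suc t) 1+t≤q = subst (+ suc q ∣_) (sym split)
      (∣m∣n⇒∣m-n (p∣neg1^t*qCt-1 t (ℕP.<⇒≤ 1+t≤q)) (∣n⇒∣m*n (neg1^ t) (∣ᵤ⇒∣ (p∣pC[1+t] t 1+t≤q))))
      where
      split : - neg1^ t * + (q C suc t) - + 1 ≡ (neg1^ t * + (q C t) - + 1) - neg1^ t * + (suc q C suc t)
      split = begin
        - neg1^ t * + (q C suc t) - + 1
          ≡⟨ regroup (neg1^ t) (+ (q C t)) (+ (q C suc t)) ⟩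
        (neg1^ t * + (q C t) - + 1) - neg1^ t * (+ (q C t) + + (q C suc t))
          ≡⟨ cong (λ z → (neg1^ t * + (q C t) - + 1) - neg1^ t * z) (ℤP.pos-+ (q C t) _) ⟨
        (neg1^ t * + (q C t) - + 1) - neg1^ t * + (q C t ℕ.+ q C suc t)
          ≡⟨ cong (λ z → (neg1^ t * + (q C t) - + 1) - neg1^ t * + z) (nCk+nC[k+1]≡[n+1]C[k+1] q t) ⟩
        (neg1^ t * + (q C t) - + 1) - neg1^ t * + (suc q C suc t) ∎
        where regroup : ∀ x a b → - x * b - + 1 ≡ (x * a - + 1) - x * (a + b)
              regroup = solve-∀

    π^q≈p·W : ∃ λ W → π^ q ≈ + suc q · W
    π^q≈p·W = W , ≈[ + 1 , (λ k → begin
        π^ q k - + suc q * W k                           ≡⟨ cong (_- + suc q * W k) (π^-coefficient q ℕP.≤-refl k) ⟩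
        neg1^ (toℕ k) * + (q C toℕ k) - + suc q * W k   ≡⟨ cong (λ z → neg1^ (toℕ k) * + (q C toℕ k) - z) (ℤP.*-comm (+ suc q) (W k)) ⟩
        neg1^ (toℕ k) * + (q C toℕ k) - W k * + suc q   ≡⟨ cong (λ z → neg1^ (toℕ k) * + (q C toℕ k) - z) (_∣_.equality (divisibility k)) ⟨
        neg1^ (toℕ k) * + (q C toℕ k) - (neg1^ (toℕ k) * + (q C toℕ k) - + 1)  ≡⟨ cancel (neg1^ (toℕ k) * + (q C toℕ k)) ⟩
        + 1                                             ∎) ]
      where
      divisibility : ∀ k → + suc q ∣ neg1^ (toℕ k) * + (q C toℕ k) - + 1
      divisibility k = p∣neg1^t*qCt-1 (toℕ k) (ℕP.≤-pred (FP.toℕ<n k))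
      W : ℤ[C]
      W k = _∣_.quotient (divisibility k)
      cancel : ∀ x → x - (x - + 1) ≡ + 1
      cancel = solve-∀

  module CyclotomicDomain (q : ℕ) (p-prime : Prime (suc q)) where
    open GF (suc q)
    open GroupRing (suc q)
    open PowersOfπ q p-prime
    open Cyclotomic q 1≤q

    p : ℕ
    p = suc q

    p∣_ : ℤ[C] → Set
    p∣ a = ∃ λ a′ → a ≈ + p · a′

    π^q⋆-p∣ : ∀ {a} c → a ≈ π^ q ⋆ c → p∣ a
    π^q⋆-p∣ c h with π^q≈p·W
    ... | W , π^q≈pW = W ⋆ c , ≈-trans h (≈-trans (⋆-congˡ c π^q≈pW) (≗⇒≈ (·-⋆ (+ p) W c)))

    π^-⋆-π : ∀ i c → π^ i ⋆ (π ⋆ c) ≗ π^ (suc i) ⋆ c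
    π^-⋆-π i c k = trans (sym (⋆-assoc (π^ i) π c k)) (⋆-cong-≗ˡ c (⋆-comm (π^ i) π) k)

    absorb-π : ∀ {a} i {c c′} → a ≈ π^ i ⋆ c → c ≈ π ⋆ c′ → a ≈ π^ (suc i) ⋆ c′
    absorb-π i {c′ = c′} a≈ c≈ = ≈-trans a≈ (≈-trans (⋆-congʳ (π^ i) c≈) (≗⇒≈ (π^-⋆-π i c′)))

    ⋆≈𝟘-comm : ∀ a b → a ⋆ b ≈ 𝟘 → b ⋆ a ≈ 𝟘
    ⋆≈𝟘-comm a b = ≈-respˡ-≗ (⋆-comm a b)

    cancel-π : ∀ {c c′ d} → c ≈ π ⋆ c′ → c ⋆ d ≈ 𝟘 → c′ ⋆ d ≈ 𝟘
    cancel-π {c} {c′} {d} c≈ cd≈0 =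
      π⋆-injective (c′ ⋆ d) (≈-respˡ-≗ (⋆-assoc π c′ d) (≈-trans (⋆-congˡ d (≈-sym c≈)) cd≈0))

    -- p divides aug c · aug d = aug (c ⋆ d), hence one of the augmentations, so a factor π can be
    -- moved out of c or d; once π^(p-1) has been collected on one side, that side is divisible by p.
    collect-π : ∀ m n {a b} i j c d → i ℕ.+ m ≡ q → j ℕ.+ n ≡ q →
                a ≈ π^ i ⋆ c → b ≈ π^ j ⋆ d → c ⋆ d ≈ 𝟘 → p∣ a ⊎ p∣ b
    collect-π zero n {a} i j c d i≡q _ a≈ _ _ =
      inj₁ (π^q⋆-p∣ c (subst (λ z → a ≈ π^ z ⋆ c) (trans (sym (ℕP.+-identityʳ i)) i≡q) a≈))
    collect-π (suc m) zero {b = b} i j c d _ j≡q _ b≈ _ =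
      inj₂ (π^q⋆-p∣ d (subst (λ z → b ≈ π^ z ⋆ d) (trans (sym (ℕP.+-identityʳ j)) j≡q) b≈))
    collect-π (suc m) (suc n) {a} {b} i j c d i+1+m≡q j+1+n≡q a≈ b≈ cd≈0 =
      [ factor-c , factor-d ]′ (ℤ-euclidsLemma p-prime (aug c) (aug d) (subst (+ p ∣_) (aug-⋆ c d) (≈𝟘⇒p∣aug cd≈0)))
      where
      factor-c : + p ∣ aug c → p∣ a ⊎ p∣ b
      factor-c p∣aug-c = continue-c (p∣aug⇒π∣ c p∣aug-c)
        where
        continue-c : (∃ λ c′ → c ≈ π ⋆ c′) → p∣ a ⊎ p∣ b
        continue-c (c′ , c≈πc′) =
          collect-π m (suc n) (suc i) j c′ d (trans (sym (ℕP.+-suc i m)) i+1+m≡q) j+1+n≡q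
                    (absorb-π i {c} {c′} a≈ c≈πc′) b≈ (cancel-π {c} {c′} {d} c≈πc′ cd≈0)
      factor-d : + p ∣ aug d → p∣ a ⊎ p∣ b
      factor-d p∣aug-d = continue-d (p∣aug⇒π∣ d p∣aug-d)
        where
        continue-d : (∃ λ d′ → d ≈ π ⋆ d′) → p∣ a ⊎ p∣ b
        continue-d (d′ , d≈πd′) =
          collect-π (suc m) n i (suc j) c d′ i+1+m≡q (trans (sym (ℕP.+-suc j n)) j+1+n≡q)
                    a≈ (absorb-π j {d} {d′} b≈ d≈πd′) (⋆≈𝟘-comm d′ c (cancel-π {d} {d′} {c} d≈πd′ (⋆≈𝟘-comm c d cd≈0)))

    ⋆≈𝟘⇒p∣ : ∀ a b → a ⋆ b ≈ 𝟘 → p∣ a ⊎ p∣ b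
    ⋆≈𝟘⇒p∣ a b ab≈0 = collect-π q q 0 0 a b refl refl (≗⇒≈ (sym ∘ δ0-⋆ a)) (≗⇒≈ (sym ∘ δ0-⋆ b)) ab≈0

    p·-cancel : ∀ x → + p · x ≈ 𝟘 → x ≈ 𝟘
    p·-cancel x h = const⇒≈𝟘 (x 0F) (λ k → ℤP.*-cancelˡ-≡ (+ p) (x k) (x 0F) (≈𝟘⇒const h k))

    size : ℤ[C] → ℕ
    size a = ℕΣ.sum (λ k → ℤ.∣ a k - a 0F ∣)

    size-· : ∀ {a} x → a ≈ + p · x → size a ≡ p ℕ.* size x
    size-· {a} x ≈[ s , e ] = begin
      ℕΣ.sum (λ k → ℤ.∣ a k - a 0F ∣)                 ≡⟨ ℕΣ.sum-cong-≗ (λ k → cong ℤ.∣_∣ (difference k)) ⟩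
      ℕΣ.sum (λ k → ℤ.∣ + p * (x k - x 0F) ∣)         ≡⟨ ℕΣ.sum-cong-≗ (λ k → ℤP.abs-* (+ p) (x k - x 0F)) ⟩
      ℕΣ.sum (λ k → p ℕ.* ℤ.∣ x k - x 0F ∣)           ≡⟨ ℕΣ.*-distribˡ-sum p (λ k → ℤ.∣ x k - x 0F ∣) ⟨
      p ℕ.* size x                                    ∎
      where
      regroup : ∀ ak a0 xk x0 P → ak - a0 ≡ (ak - P * xk) - (a0 - P * x0) + P * (xk - x0)
      regroup = solve-∀
      difference : ∀ k → a k - a 0F ≡ + p * (x k - x 0F)
      difference k = begin
        a k - a 0F                                                      ≡⟨ regroup (a k) (a 0F) (x k) (x 0F) (+ p) ⟩
        (a k - + p * x k) - (a 0F - + p * x 0F) + + p * (x k - x 0F)  ≡⟨ cong₂ (λ u v → u - v + + p * (x k - x 0F)) (e k) (e 0F) ⟩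
        s - s + + p * (x k - x 0F)                                      ≡⟨ cong (_+ + p * (x k - x 0F)) (ℤP.+-inverseʳ s) ⟩
        + 0 + + p * (x k - x 0F)                                        ≡⟨ ℤP.+-identityˡ _ ⟩
        + p * (x k - x 0F)                                              ∎

    size≡0⇒≈𝟘 : ∀ x → size x ≡ 0 → x ≈ 𝟘
    size≡0⇒≈𝟘 x h = const⇒≈𝟘 (x 0F) (λ k → ℤP.i-j≡0⇒i≡j (x k) (x 0F) (ℤP.∣i∣≡0⇒i≡0 (ℕsum≡0⇒≡0 (λ k → ℤ.∣ x k - x 0F ∣) h k)))

    size-decreases : ∀ {a} a′ → a ≈ + p · a′ → ¬ a′ ≈ 𝟘 → size a′ < size a
    size-decreases a′ a≈pa′ a′≉0 with size a′ in eq
    ... | zero  = ⊥-elim (a′≉0 (size≡0⇒≈𝟘 a′ eq))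
    ... | suc s = subst (suc s <_) (sym (trans (size-· a′ a≈pa′) (trans (cong (p ℕ.*_) eq) (ℕP.*-comm p (suc s)))))
                        (ℕP.m<m*n (suc s) p (s≤s 1≤q))

    divide-out-p : ∀ {a} a′ b → a ≈ + p · a′ → a ⋆ b ≈ 𝟘 → ¬ a ≈ 𝟘 → a′ ⋆ b ≈ 𝟘 × ¬ a′ ≈ 𝟘 × size a′ < size a
    divide-out-p {a} a′ b a≈pa′ ab≈0 a≉0 = a′b≈0 , a′≉0 , size-decreases a′ a≈pa′ a′≉0
      where
      a′b≈0 : a′ ⋆ b ≈ 𝟘
      a′b≈0 = p·-cancel (a′ ⋆ b) (≈-respˡ-≗ (·-⋆ (+ p) a′ b) (≈-trans (⋆-congˡ b (≈-sym a≈pa′)) ab≈0))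
      a′≉0 : ¬ a′ ≈ 𝟘
      a′≉0 a′≈0 = a≉0 (≈-trans a≈pa′ (·-≈𝟘 (+ p) a′≈0))

    -- Induction on the total size: a factor p can always be divided out of a or b.
    no-zero-divisors-below : ∀ F a b → size a ℕ.+ size b < F → a ⋆ b ≈ 𝟘 → ¬ a ≈ 𝟘 → ¬ b ≈ 𝟘 → ⊥
    no-zero-divisors-below (suc F) a b bound ab≈0 a≉0 b≉0 = [ divide-a , divide-b ]′ (⋆≈𝟘⇒p∣ a b ab≈0)
      where
      divide-a : p∣ a → ⊥
      divide-a (a′ , a≈pa′) = continue (divide-out-p a′ b a≈pa′ ab≈0 a≉0)
        where
        continue : a′ ⋆ b ≈ 𝟘 × ¬ a′ ≈ 𝟘 × size a′ < size a → ⊥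
        continue (a′b≈0 , a′≉0 , smaller) =
          no-zero-divisors-below F a′ b (ℕP.<-≤-trans (ℕP.+-monoˡ-< (size b) smaller) (ℕP.≤-pred bound)) a′b≈0 a′≉0 b≉0
      divide-b : p∣ b → ⊥
      divide-b (b′ , b≈pb′) = continue (divide-out-p b′ a b≈pb′ (⋆≈𝟘-comm a b ab≈0) b≉0)
        where
        continue : b′ ⋆ a ≈ 𝟘 × ¬ b′ ≈ 𝟘 × size b′ < size b → ⊥
        continue (b′a≈0 , b′≉0 , smaller) =
          no-zero-divisors-below F a b′ (ℕP.<-≤-trans (ℕP.+-monoʳ-< (size a) smaller) (ℕP.≤-pred bound)) (⋆≈𝟘-comm b′ a b′a≈0) a≉0 b′≉0

    a⋆b≈𝟘⇒a≈𝟘∨b≈𝟘 : ∀ a b → a ⋆ b ≈ 𝟘 → a ≈ 𝟘 ⊎ b ≈ 𝟘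
    a⋆b≈𝟘⇒a≈𝟘∨b≈𝟘 a b ab≈0 with ≈𝟘? a | ≈𝟘? b
    ... | yes a≈0 | _       = inj₁ a≈0
    ... | no _    | yes b≈0 = inj₂ b≈0
    ... | no a≉0  | no b≉0  = ⊥-elim (no-zero-divisors-below (suc (size a ℕ.+ size b)) a b ℕP.≤-refl ab≈0 a≉0 b≉0)

  -- Character sums and eigenvalues of Cayley graphs

  module PrimeField (q : ℕ) (p-prime : Prime (suc q)) where
    open GF (suc q)
    open ModularArithmetic (suc q)
    open Vectors (suc q)

    coprime-p : ∀ (a : Fin (suc q)) → a ≢ 0F → Coprime (toℕ a) (suc q)
    coprime-p a a≢0 {d} (d∣a , d∣p) with prime⇒irreducible p-prime d∣p
    ... | inj₁ d≡1 = d≡1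
    ... | inj₂ refl = ⊥-elim (ℕP.<⇒≱ (FP.toℕ<n a) (ℕ∣.∣⇒≤ {{ℕ.≢-nonZero toℕa≢0}} d∣a))
      where
      toℕa≢0 : toℕ a ≢ 0
      toℕa≢0 e = a≢0 (FP.toℕ-injective (trans e (sym toℕ-0F)))

    -- Both Bézout cases give x·a ≡ ±1 (mod p).
    *F-inverse : ∀ (a : Fin (suc q)) → a ≢ 0F → ∃ λ c → a *F c ≡ 1F
    *F-inverse a a≢0 with Bézout.identity (coprime⇒GCD≡1 (coprime-p a a≢0))
    ... | Bézout.+- x y eq = ofℕ x , (begin
      ofℕ (toℕ a ℕ.* toℕ (ofℕ x))  ≡⟨ ofℕ-absorbʳ-* (toℕ a) x ⟩
      ofℕ (toℕ a ℕ.* x)            ≡⟨ cong ofℕ (ℕP.*-comm (toℕ a) x) ⟩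
      ofℕ (x ℕ.* toℕ a)            ≡⟨ cong ofℕ eq ⟨
      ofℕ (1 ℕ.+ y ℕ.* suc q)      ≡⟨ ofℕ-cong-% {1 ℕ.+ y ℕ.* suc q} {1} ([m+kn]%n≡m%n 1 y (suc q)) ⟩
      ofℕ 1                        ∎)
    ... | Bézout.-+ x y eq = -F (ofℕ x) , (begin
      a *F (-F (ofℕ x))   ≡⟨ -F-distribʳ-*F a (ofℕ x) ⟩
      -F (a *F ofℕ x)     ≡⟨ cong -F_ ax≡-1 ⟩
      -F (-F 1F)          ≡⟨ -F-involutive 1F ⟩
      1F                  ∎)
      where
      ax+1≡0 : (a *F ofℕ x) +F 1F ≡ 0F
      ax+1≡0 = begin
        ofℕ (toℕ (a *F ofℕ x) ℕ.+ toℕ (ofℕ 1))  ≡⟨ ofℕ-absorbʳ-+ (toℕ (a *F ofℕ x)) 1 ⟩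
        ofℕ (toℕ (a *F ofℕ x) ℕ.+ 1)            ≡⟨ cong (λ z → ofℕ (toℕ z ℕ.+ 1)) (trans (*F-comm a (ofℕ x)) (ofℕ-absorbˡ-* x (toℕ a))) ⟩
        ofℕ (toℕ (ofℕ (x ℕ.* toℕ a)) ℕ.+ 1)     ≡⟨ ofℕ-absorbˡ-+ (x ℕ.* toℕ a) 1 ⟩
        ofℕ (x ℕ.* toℕ a ℕ.+ 1)                 ≡⟨ cong ofℕ (trans (ℕP.+-comm _ 1) eq) ⟩
        ofℕ (y ℕ.* suc q)                       ≡⟨ ofℕ-cong-% {y ℕ.* suc q} {0} ([m+kn]%n≡m%n 0 y (suc q)) ⟩
        ofℕ 0                                   ∎
      ax≡-1 : a *F ofℕ x ≡ -F 1F
      ax≡-1 = +F-cancelʳ 1F (trans ax+1≡0 (sym (+F-inverseˡ 1F)))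

    ⟪⟫-surjective : ∀ {n} (x : Vec (Fin (suc q)) n) → x ≢ V0 n → ∀ t → ∃ λ e → ⟪ x , e ⟫ ≡ t
    ⟪⟫-surjective [] x≢0 t = ⊥-elim (x≢0 refl)
    ⟪⟫-surjective (a ∷ x) x≢0 t with a F.≟ 0F
    ... | yes refl with ⟪⟫-surjective x (x≢0 ∘ cong (0F ∷_)) t
    ...   | e , xe≡t = 0F ∷ e , trans (cong₂ _+F_ (*F-zeroˡ 0F) xe≡t) (+F-identityˡ t)
    ⟪⟫-surjective (a ∷ x) x≢0 t | no a≢0 with *F-inverse a a≢0
    ... | c , ac≡1 = c *F t ∷ V0 _ , (begin
      (a *F (c *F t)) +F ⟪ x , V0 _ ⟫  ≡⟨ cong₂ _+F_ (sym (*F-assoc a c t)) (⟪⟫-V0ʳ x) ⟩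
      ((a *F c) *F t) +F 0F            ≡⟨ +F-identityʳ _ ⟩
      (a *F c) *F t                    ≡⟨ cong (_*F t) ac≡1 ⟩
      1F *F t                          ≡⟨ *F-identityˡ t ⟩
      t                                ∎)

  module Characters (p : ℕ) .{{_ : NonZero p}} {n : ℕ} (x : Vec (Fin p) n) where
    open GF p
    open ModularArithmetic p
    open Vectors p
    open VectorSums p
    open GroupRing p

    φ : Vec (Fin p) n → Fin p
    φ y = -F ⟪ x , y ⟫

    χ : Fin p → Vec (Fin p) n → ℤ
    χ k y = ⟦ φ y ==F k ⟧

    fibre : ℤ[C]
    fibre k = vsum n (χ k)

    φ-vadd : ∀ v w → φ (vadd v w) ≡ φ v +F φ w
    φ-vadd v w = trans (cong -F_ (⟪⟫-vadd x v w)) (-F-distrib-+F ⟪ x , v ⟫ ⟪ x , w ⟫)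

    χ-V0 : ∀ k → χ k (V0 n) ≡ δ 0F k
    χ-V0 k = cong (λ u → ⟦ u ==F k ⟧) (trans (cong -F_ (⟪⟫-V0ʳ x)) -F-0F)

    ==F-shift : ∀ u b k → ((u +F b) ==F k) ≡ (u ==F (k ⊖ b))
    ==F-shift u b k = isYes-cong ((u +F b) F.≟ k) (u F.≟ (k ⊖ b)) a+b≡c⇒a≡c⊖b a≡c⊖b⇒a+b≡c

    χ-vadd : ∀ k v w → χ k (vadd v w) ≡ χ (k ⊖ φ w) v
    χ-vadd k v w = cong ⟦_⟧ (trans (cong (_==F k) (φ-vadd v w)) (==F-shift (φ v) (φ w) k))

  module FibreConstant (q : ℕ) (p-prime : Prime (suc q)) {n : ℕ} (x : Vec (Fin (suc q)) n) (x≢0 : x ≢ GF.V0 (suc q) n) where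
    open GF (suc q)
    open ModularArithmetic (suc q)
    open VectorSums (suc q)
    open Characters (suc q) x
    open Cyclotomic q (prime[1+q]⇒1≤q p-prime)

    φ-surjective : ∀ t → ∃ λ e → φ e ≡ t
    φ-surjective t = map₂ (λ xe≡-t → trans (cong -F_ xe≡-t) (-F-involutive t)) (PrimeField.⟪⟫-surjective q p-prime x x≢0 (-F t))

    -- Translating by a vector e with φ e = 1 maps each fibre onto the next one.
    fibre-shift : ∀ k → fibre k ≡ fibre (k ⊖ 1F)
    fibre-shift k = trans (vsum-translate n (χ k) e) (vsum-cong n (λ y → trans (χ-vadd k y e) (cong (λ z → χ (k ⊖ z) y) φe≡1)))
      where
      e : Vec (Fin (suc q)) n
      e = proj₁ (φ-surjective 1F)
      φe≡1 : φ e ≡ 1F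
      φe≡1 = proj₂ (φ-surjective 1F)

    fibre-ofℕ : ∀ t → fibre (ofℕ t) ≡ fibre 0F
    fibre-ofℕ zero = refl
    fibre-ofℕ (suc t) = trans (fibre-shift (ofℕ (suc t))) (trans (cong fibre (ofℕ-suc⊖1F t)) (fibre-ofℕ t))

    fibre-constant : ∀ k → fibre k ≡ fibre 0F
    fibre-constant k = trans (cong fibre (sym (ofℕ-toℕ k))) (fibre-ofℕ (toℕ k))

  module CayleyGraph (p : ℕ) .{{_ : NonZero p}} {n : ℕ} (D : Vec (Fin p) n → Bool)
                     (D-V0 : D (GF.V0 p n) ≡ false) (D-even : ∀ y → D (GF.vneg p y) ≡ D y) where
    open GF p
    open ModularArithmetic p
    open Vectors p
    open VectorSums p
    open GroupRing p

    Γ : Vec (Fin p) n → Vec (Fin p) n → Bool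
    Γ z w = not (z ==V w) ∧ D (vsub z w)

    Γ≡D-vsub : ∀ z w → Γ z w ≡ D (vsub z w)
    Γ≡D-vsub z w with z ==V w in z==w
    ... | false = refl
    ... | true  = sym (trans (cong D (trans (cong (λ u → vsub u w) (==V⇒≡ z==w)) (vsub-self w))) D-V0)

    common-neighbours : Vec (Fin p) n → ℤ
    common-neighbours z = + count (λ w → Γ z w ∧ Γ (V0 n) w) (allVecs n)

    common-neighbours≡vsum : ∀ z → common-neighbours z ≡ vsum n (λ w → ⟦ D (vsub z w) ⟧ * ⟦ D w ⟧)
    common-neighbours≡vsum z = trans (count≡vsum n _) (vsum-cong n (λ w → begin
      ⟦ Γ z w ∧ Γ (V0 n) w ⟧        ≡⟨ ⟦∧⟧ (Γ z w) (Γ (V0 n) w) ⟩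
      ⟦ Γ z w ⟧ * ⟦ Γ (V0 n) w ⟧    ≡⟨ cong₂ (λ u v → ⟦ u ⟧ * ⟦ v ⟧) (Γ≡D-vsub z w) (Γ≡D-vsub (V0 n) w) ⟩
      ⟦ D (vsub z w) ⟧ * ⟦ D (vsub (V0 n) w) ⟧  ≡⟨ cong (λ u → ⟦ D (vsub z w) ⟧ * ⟦ u ⟧) (trans (cong D (vsub-V0ˡ w)) (D-even w)) ⟩
      ⟦ D (vsub z w) ⟧ * ⟦ D w ⟧    ∎))

    -- The coefficients of λ(x) = Σ_{y ∈ D} ζ^(φ y); for D = D_i this is GF.λcoeff.
    eigenvalue : Vec (Fin p) n → ℤ[C]
    eigenvalue x k = + count (λ y → D y ∧ (Characters.φ p x y ==F k)) (allVecs n)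

    module _ {ν K lam μ : ℤ} (srg : IsSRG (allVecs n) _==V_ Γ ν K lam μ) where
      open IsSRG srg

      common-neighbours-formula : ∀ z → common-neighbours z ≡ μ + ⟦ z ==V V0 n ⟧ * (K - μ) + ⟦ D z ⟧ * (lam - μ)
      common-neighbours-formula z with z ==V V0 n in z==0
      ... | true = begin
        common-neighbours z       ≡⟨ cong common-neighbours z≡0 ⟩
        + count (λ w → Γ (V0 n) w ∧ Γ (V0 n) w) (allVecs n) ≡⟨ cong +_ (count-cong (allVecs n) (λ w → ∧-idem (Γ (V0 n) w))) ⟩
        + count (Γ (V0 n)) (allVecs n)  ≡⟨ regular (V0 n) ⟩
        K                         ≡⟨ expand K μ lam ⟩
        μ + + 1 * (K - μ) + ⟦ false ⟧ * (lam - μ)  ≡⟨ cong (λ b → μ + + 1 * (K - μ) + ⟦ b ⟧ * (lam - μ)) (trans (cong D z≡0) D-V0) ⟨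
        μ + + 1 * (K - μ) + ⟦ D z ⟧ * (lam - μ)    ∎
        where
        z≡0 : z ≡ V0 n
        z≡0 = ==V⇒≡ z==0
        expand : ∀ K μ lam → K ≡ μ + + 1 * (K - μ) + + 0 * (lam - μ)
        expand = solve-∀
      ... | false with D z in Dz
      ...   | true = trans (adjacent z (V0 n) Γz0) (expand K μ lam)
        where
        Γz0 : Γ z (V0 n) ≡ true
        Γz0 = trans (Γ≡D-vsub z (V0 n)) (trans (cong D (vsub-V0ʳ z)) Dz)
        expand : ∀ K μ lam → lam ≡ μ + + 0 * (K - μ) + + 1 * (lam - μ)
        expand = solve-∀
      ...   | false = trans (nonadjacent z (V0 n) z==0 Γz0) (expand K μ lam)
        where
        Γz0 : Γ z (V0 n) ≡ false
        Γz0 = trans (Γ≡D-vsub z (V0 n)) (trans (cong D (vsub-V0ʳ z)) Dz)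
        expand : ∀ K μ lam → μ ≡ μ + + 0 * (K - μ) + + 0 * (lam - μ)
        expand = solve-∀

    module _ (x : Vec (Fin p) n) where
      open Characters p x

      θ : ℤ[C]
      θ = eigenvalue x

      θ≡vsum : ∀ k → θ k ≡ vsum n (λ y → ⟦ D y ⟧ * χ k y)
      θ≡vsum k = trans (count≡vsum n _) (vsum-cong n (λ y → ⟦∧⟧ (D y) (φ y ==F k)))

      pairs : Fin p → ℤ
      pairs k = vsum n (λ u → vsum n (λ v → ⟦ D u ⟧ * ⟦ D v ⟧ * χ (k ⊖ φ u) v))

      θ⋆θ≡pairs : ∀ k → (θ ⋆ θ) k ≡ pairs k
      θ⋆θ≡pairs k = begin
        sum (λ j → θ j * θ (k ⊖ j))
          ≡⟨ sum-cong-≗ (λ j → cong₂ _*_ (θ≡vsum j) (θ≡vsum (k ⊖ j))) ⟩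
        sum (λ j → vsum n (λ u → ⟦ D u ⟧ * χ j u) * vsum n (λ v → ⟦ D v ⟧ * χ (k ⊖ j) v))
          ≡⟨ sum-cong-≗ (λ j → trans (sym (vsum-*ʳ n _ (λ u → ⟦ D u ⟧ * χ j u)))
                                     (vsum-cong n (λ u → sym (vsum-*ˡ n (⟦ D u ⟧ * χ j u) (λ v → ⟦ D v ⟧ * χ (k ⊖ j) v))))) ⟩
        sum (λ j → vsum n (λ u → vsum n (λ v → (⟦ D u ⟧ * χ j u) * (⟦ D v ⟧ * χ (k ⊖ j) v))))
          ≡⟨ vsum-sum-comm n (λ j u → vsum n (λ v → (⟦ D u ⟧ * χ j u) * (⟦ D v ⟧ * χ (k ⊖ j) v))) ⟨
        vsum n (λ u → sum (λ j → vsum n (λ v → (⟦ D u ⟧ * χ j u) * (⟦ D v ⟧ * χ (k ⊖ j) v))))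
          ≡⟨ vsum-cong n (λ u → sym (vsum-sum-comm n (λ j v → (⟦ D u ⟧ * χ j u) * (⟦ D v ⟧ * χ (k ⊖ j) v)))) ⟩
        vsum n (λ u → vsum n (λ v → sum (λ j → (⟦ D u ⟧ * χ j u) * (⟦ D v ⟧ * χ (k ⊖ j) v))))
          ≡⟨ vsum-cong n (λ u → vsum-cong n (λ v → collapse u v)) ⟩
        pairs k ∎
        where
        regroup : ∀ A X B Y → (A * X) * (B * Y) ≡ X * (A * B * Y)
        regroup = solve-∀
        collapse : ∀ u v → sum (λ j → (⟦ D u ⟧ * χ j u) * (⟦ D v ⟧ * χ (k ⊖ j) v)) ≡ ⟦ D u ⟧ * ⟦ D v ⟧ * χ (k ⊖ φ u) v
        collapse u v = trans (sum-cong-≗ (λ j → regroup ⟦ D u ⟧ (χ j u) ⟦ D v ⟧ (χ (k ⊖ j) v)))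
                             (sum-δ (φ u) (λ j → ⟦ D u ⟧ * ⟦ D v ⟧ * χ (k ⊖ j) v))

      χ-weighted-common≡pairs : ∀ k → vsum n (λ z → χ k z * common-neighbours z) ≡ pairs k
      χ-weighted-common≡pairs k = begin
        vsum n (λ z → χ k z * common-neighbours z)
          ≡⟨ vsum-cong n (λ z → trans (cong (χ k z *_) (common-neighbours≡vsum z)) (sym (vsum-*ˡ n (χ k z) _))) ⟩
        vsum n (λ z → vsum n (λ w → χ k z * (⟦ D (vsub z w) ⟧ * ⟦ D w ⟧)))
          ≡⟨ vsum-comm n n (λ z w → χ k z * (⟦ D (vsub z w) ⟧ * ⟦ D w ⟧)) ⟩
        vsum n (λ w → vsum n (λ z → χ k z * (⟦ D (vsub z w) ⟧ * ⟦ D w ⟧)))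
          ≡⟨ vsum-cong n (λ w → vsum-translate n (λ z → χ k z * (⟦ D (vsub z w) ⟧ * ⟦ D w ⟧)) w) ⟩
        vsum n (λ w → vsum n (λ v → χ k (vadd v w) * (⟦ D (vsub (vadd v w) w) ⟧ * ⟦ D w ⟧)))
          ≡⟨ vsum-cong n (λ w → vsum-cong n (λ v → rearrange w v)) ⟩
        pairs k ∎
        where
        regroup : ∀ X A B → X * (A * B) ≡ B * A * X
        regroup = solve-∀
        rearrange : ∀ w v → χ k (vadd v w) * (⟦ D (vsub (vadd v w) w) ⟧ * ⟦ D w ⟧) ≡ ⟦ D w ⟧ * ⟦ D v ⟧ * χ (k ⊖ φ w) v
        rearrange w v = trans (cong₂ (λ c u → c * (⟦ D u ⟧ * ⟦ D w ⟧)) (χ-vadd k v w) (vsub-vadd v w))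
                              (regroup (χ (k ⊖ φ w) v) ⟦ D v ⟧ ⟦ D w ⟧)

      module _ {ν K lam μ : ℤ} (srg : IsSRG (allVecs n) _==V_ Γ ν K lam μ) where

        χ-weighted-common≡ : ∀ k → vsum n (λ z → χ k z * common-neighbours z) ≡ μ * fibre k + (K - μ) * δ 0F k + (lam - μ) * θ k
        χ-weighted-common≡ k = begin
          vsum n (λ z → χ k z * common-neighbours z)
            ≡⟨ vsum-cong n (λ z → trans (cong (χ k z *_) (common-neighbours-formula srg z)) (distribute (χ k z) μ K lam ⟦ z ==V V0 n ⟧ ⟦ D z ⟧)) ⟩
          vsum n (λ z → (μ * χ k z + (K - μ) * (⟦ z ==V V0 n ⟧ * χ k z)) + (lam - μ) * (⟦ D z ⟧ * χ k z))
            ≡⟨ vsum-distrib-+ n _ _ ⟩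
          vsum n (λ z → μ * χ k z + (K - μ) * (⟦ z ==V V0 n ⟧ * χ k z)) + vsum n (λ z → (lam - μ) * (⟦ D z ⟧ * χ k z))
            ≡⟨ cong₂ _+_ (vsum-distrib-+ n _ _) (vsum-*ˡ n (lam - μ) _) ⟩
          vsum n (λ z → μ * χ k z) + vsum n (λ z → (K - μ) * (⟦ z ==V V0 n ⟧ * χ k z)) + (lam - μ) * vsum n (λ z → ⟦ D z ⟧ * χ k z)
            ≡⟨ cong₂ (λ u v → u + v + (lam - μ) * vsum n (λ z → ⟦ D z ⟧ * χ k z)) (vsum-*ˡ n μ (χ k)) (vsum-*ˡ n (K - μ) _) ⟩
          μ * fibre k + (K - μ) * vsum n (λ z → ⟦ z ==V V0 n ⟧ * χ k z) + (lam - μ) * vsum n (λ z → ⟦ D z ⟧ * χ k z)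
            ≡⟨ cong₂ (λ u v → μ * fibre k + (K - μ) * u + (lam - μ) * v) (trans (vsum-δ n (V0 n) (χ k)) (χ-V0 k)) (sym (θ≡vsum k)) ⟩
          μ * fibre k + (K - μ) * δ 0F k + (lam - μ) * θ k ∎
          where
          distribute : ∀ c μ K lam X d → c * (μ + X * (K - μ) + d * (lam - μ)) ≡ (μ * c + (K - μ) * (X * c)) + (lam - μ) * (d * c)
          distribute = solve-∀

        -- Both sides count the pairs (u, v) ∈ D² with φ (u + v) = k: directly, and grouped by z = u + v.
        eigenvalue-equation : ∀ k → (θ ⋆ θ) k ≡ μ * fibre k + (K - μ) * δ 0F k + (lam - μ) * θ k
        eigenvalue-equation k = trans (θ⋆θ≡pairs k) (trans (sym (χ-weighted-common≡pairs k)) (χ-weighted-common≡ k))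

  module EigenvalueDichotomy (q : ℕ) (p-prime : Prime (suc q)) {n : ℕ} (D : Vec (Fin (suc q)) n → Bool)
                             (D-V0 : D (GF.V0 (suc q) n) ≡ false) (D-even : ∀ y → D (GF.vneg (suc q) y) ≡ D y)
                             (x : Vec (Fin (suc q)) n) (x≢0 : x ≢ GF.V0 (suc q) n) where
    open GF (suc q)
    open GroupRing (suc q)
    open CayleyGraph (suc q) D D-V0 D-even using (Γ; eigenvalue; eigenvalue-equation)
    open Characters (suc q) x using (fibre)
    open FibreConstant q p-prime x x≢0 using (fibre-constant)
    open CyclotomicDomain q p-prime using (a⋆b≈𝟘⇒a≈𝟘∨b≈𝟘)

    -- With μ = r² - r, K - μ = N r - r² and λ - μ = N - 2r, the eigenvalue equation reads
    -- (θ - (N - r)) (θ + r) = μ · fibre, a constant since x ≠ 0.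
    eigenvalue-dichotomy : ∀ N r → IsSRG (allVecs n) _==V_ Γ (N * N) ((N - + 1) * r) (N + r * r - + 3 * r) (r * r - r) →
                           eigenvalue x ≈ζ intζ (N - r) ⊎ eigenvalue x ≈ζ intζ (- r)
    eigenvalue-dichotomy N r srg =
      Sum.map (⊕-≈𝟘⇒≈intζ θ (N - r)) (⊕-≈𝟘⇒≈intζ θ (- r)) (a⋆b≈𝟘⇒a≈𝟘∨b≈𝟘 (θ ⊕ α) (θ ⊕ β) product≈𝟘)
      where
      θ : ℤ[C]
      θ = eigenvalue x
      α β : ℤ
      α = - (N - r)
      β = - (- r)
      factor : ∀ N r H E A → ((r * r - r) * H + ((N - + 1) * r - (r * r - r)) * E + ((N + r * r - + 3 * r) - (r * r - r)) * A)
                             + (- (N - r) + - (- r)) * A + - (N - r) * - (- r) * E ≡ (r * r - r) * H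
      factor = solve-∀
      product≈𝟘 : (θ ⊕ α) ⋆ (θ ⊕ β) ≈ 𝟘
      product≈𝟘 = const⇒≈𝟘 ((r * r - r) * fibre 0F) (λ k → begin
        ((θ ⊕ α) ⋆ (θ ⊕ β)) k
          ≡⟨ ⊕-⋆-⊕ θ α β k ⟩
        (θ ⋆ θ) k + (α + β) * θ k + α * β * δ 0F k
          ≡⟨ cong (λ z → z + (α + β) * θ k + α * β * δ 0F k) (eigenvalue-equation x srg k) ⟩
        ((r * r - r) * fibre k + ((N - + 1) * r - (r * r - r)) * δ 0F k + ((N + r * r - + 3 * r) - (r * r - r)) * θ k)
          + (α + β) * θ k + α * β * δ 0F k
          ≡⟨ cong (λ h → ((r * r - r) * h + ((N - + 1) * r - (r * r - r)) * δ 0F k + ((N + r * r - + 3 * r) - (r * r - r)) * θ k)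
                          + (α + β) * θ k + α * β * δ 0F k) (fibre-constant k) ⟩
        ((r * r - r) * fibre 0F + ((N - + 1) * r - (r * r - r)) * δ 0F k + ((N + r * r - + 3 * r) - (r * r - r)) * θ k)
          + (α + β) * θ k + α * β * δ 0F k
          ≡⟨ factor N r (fibre 0F) (δ 0F k) (θ k) ⟩
        (r * r - r) * fibre 0F ∎)

  -- Functions of (negative) Latin square type

  n<ᵇn≡false : ∀ n → (n <ᵇ n) ≡ false
  n<ᵇn≡false zero = refl
  n<ᵇn≡false (suc n) = n<ᵇn≡false n

  inj₁? : ∀ {A B : Set} → A ⊎ B → Bool
  inj₁? (inj₁ _) = true
  inj₁? (inj₂ _) = false

  inj₁?≡true⇒ : ∀ {A B : Set} (d : A ⊎ B) → inj₁? d ≡ true → A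
  inj₁?≡true⇒ (inj₁ a) _ = a

  inj₁?≡false⇒ : ∀ {A B : Set} (d : A ⊎ B) → inj₁? d ≡ false → B
  inj₁?≡false⇒ (inj₂ b) _ = b

  p*Nover≡Nval : ∀ q s m → 1 ≤ m → + suc q * GF.Nover (suc q) s m ≡ GF.Nval (suc q) s m
  p*Nover≡Nval q true (suc m) _ = sym (ℤP.pos-* (suc q) (suc q ^ m))
  p*Nover≡Nval q false (suc m) _ = trans (sym (ℤP.neg-distribʳ-* (+ suc q) (+ (suc q ^ m)))) (cong -_ (sym (ℤP.pos-* (suc q) (suc q ^ m))))

  Nval≢0 : ∀ q s m → GF.Nval (suc q) s m ≢ + 0
  Nval≢0 q true m e = ℕP.<⇒≢ (ℕP.m^n>0 (suc q) m) (sym (ℤP.+-injective e))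
  Nval≢0 q false m e = ℕP.<⇒≢ (ℕP.m^n>0 (suc q) m) (sym (ℤP.+-injective (trans (sym (ℤP.neg-involutive (+ (suc q ^ m)))) (cong -_ e))))

  -- The classes D_1, …, D_p are enumerated by Fin p, with D_p first: then the sum over
  -- Fin (suc q) splits definitionally into D_p and the fibres f⁻¹(1), …, f⁻¹(p - 1).
  module Classes (q : ℕ) {n : ℕ} (f : Vec (Fin (suc q)) n → Fin (suc q)) where
    open GF (suc q)
    open ModularArithmetic (suc q)
    open Vectors (suc q)

    index : Fin (suc q) → ℕ
    index F.zero = suc q
    index (F.suc u) = suc (toℕ u)

    index-bounds : ∀ t → 1 ≤ index t × index t ≤ suc q
    index-bounds F.zero = s≤s z≤n , ℕP.≤-refl
    index-bounds (F.suc u) = s≤s z≤n , s≤s (ℕP.<⇒≤ (FP.toℕ<n u))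

    index-surjective : ∀ i → 1 ≤ i → i ≤ suc q → ∃ λ t → index t ≡ i
    index-surjective (suc i) _ 1+i≤p with i ℕ.≟ q
    ... | yes refl = F.zero , refl
    ... | no i≢q = F.suc (fromℕ< i<q) , cong suc (FP.toℕ-fromℕ< i<q)
      where
      i<q : i < q
      i<q = ℕP.≤∧≢⇒< (ℕP.≤-pred 1+i≤p) i≢q

    ind-index-suc : ∀ u y → ind f (suc (toℕ u)) y ≡ (f y ==F F.suc u)
    ind-index-suc u y = begin
      ind f (suc (toℕ u)) y
        ≡⟨ cong (λ b → if b then f y ==F ofℕ (suc (toℕ u)) else ((f y ==F 0F) ∧ not (y ==V V0 n)))
                (Equivalence.to T-≡ (ℕP.<⇒<ᵇ (s≤s (FP.toℕ<n u)))) ⟩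
      (f y ==F ofℕ (suc (toℕ u)))  ≡⟨ cong (f y ==F_) (ofℕ-toℕ (F.suc u)) ⟩
      (f y ==F F.suc u)            ∎

    ind-p : ∀ y → ind f (suc q) y ≡ ((f y ==F 0F) ∧ not (y ==V V0 n))
    ind-p y = cong (λ b → if b then f y ==F ofℕ (suc q) else ((f y ==F 0F) ∧ not (y ==V V0 n))) (n<ᵇn≡false (suc q))

    ind-even : Even f → ∀ i y → ind f i (vneg y) ≡ ind f i y
    ind-even f-even i y =
      cong₂ (λ u w → if i <ᵇ suc q then (u ==F ofℕ i) else ((u ==F 0F) ∧ not w)) (f-even y) (vneg-==V0 y)

    module _ (f-V0 : f (V0 n) ≡ 0F) where

      ind-V0 : ∀ i → 1 ≤ i → ind f i (V0 n) ≡ false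
      ind-V0 i 1≤i with i <ᵇ suc q in i<ᵇp
      ... | true = trans (cong (_==F ofℕ i) f-V0) (==F-false 0F≢i)
        where
        i<p : i < suc q
        i<p = ℕP.<ᵇ⇒< i (suc q) (subst T (sym i<ᵇp) tt)
        0F≢i : 0F ≢ ofℕ i
        0F≢i e = ℕP.<⇒≢ 1≤i (sym (begin
          i              ≡⟨ m<n⇒m%n≡m i<p ⟨
          i % suc q      ≡⟨ toℕ-ofℕ i ⟨
          toℕ (ofℕ i)    ≡⟨ cong toℕ e ⟨
          toℕ 0F         ≡⟨ toℕ-0F ⟩
          0              ∎))
      ... | false = trans (cong₂ (λ u v → (u ==F 0F) ∧ not v) f-V0 (==V-refl (V0 n))) (∧-zeroʳ (0F ==F 0F))

      classes-partition : ∀ y → sum (λ t → ⟦ ind f (index t) y ⟧) ≡ ⟦ not (y ==V V0 n) ⟧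
      classes-partition y = begin
        ⟦ ind f (suc q) y ⟧ + sum {q} (λ u → ⟦ ind f (suc (toℕ u)) y ⟧)
          ≡⟨ cong₂ (λ a b → ⟦ a ⟧ + b) (ind-p y) (sum-cong-≗ (λ u → cong ⟦_⟧ (ind-index-suc u y))) ⟩
        ⟦ (f y ==F 0F) ∧ not (y ==V V0 n) ⟧ + sum (λ u → ⟦ f y ==F F.suc u ⟧)
          ≡⟨ cong (λ z → ⟦ (f y ==F 0F) ∧ not (y ==V V0 n) ⟧ + z) nonzero-values ⟩
        ⟦ (f y ==F 0F) ∧ not (y ==V V0 n) ⟧ + (+ 1 - ⟦ f y ==F 0F ⟧)
          ≡⟨ combine (f y ==F 0F) (y ==V V0 n) y≡0⇒fy≡0 ⟩
        ⟦ not (y ==V V0 n) ⟧ ∎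
        where
        0F≡zero : 0F ≡ F.zero
        0F≡zero = FP.toℕ-injective toℕ-0F
        all-values : sum (λ j → ⟦ f y ==F j ⟧) ≡ + 1
        all-values = trans (sum-cong-≗ (λ j → sym (ℤP.*-identityʳ ⟦ f y ==F j ⟧))) (sum-δ (f y) (λ _ → + 1))
        nonzero-values : sum (λ u → ⟦ f y ==F F.suc u ⟧) ≡ + 1 - ⟦ f y ==F 0F ⟧
        nonzero-values = begin
          sum (λ u → ⟦ f y ==F F.suc u ⟧)                              ≡⟨ cancel ⟦ f y ==F F.zero ⟧ _ ⟨
          ⟦ f y ==F F.zero ⟧ + sum (λ u → ⟦ f y ==F F.suc u ⟧) - ⟦ f y ==F F.zero ⟧  ≡⟨ cong₂ _-_ all-values (cong (λ z → ⟦ f y ==F z ⟧) (sym 0F≡zero)) ⟩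
          + 1 - ⟦ f y ==F 0F ⟧                                         ∎
          where cancel : ∀ a S → a + S - a ≡ S
                cancel = solve-∀
        y≡0⇒fy≡0 : (y ==V V0 n) ≡ true → (f y ==F 0F) ≡ true
        y≡0⇒fy≡0 e = trans (cong (λ u → f u ==F 0F) (==V⇒≡ e)) (trans (cong (_==F 0F) f-V0) (==F-refl 0F))
        combine : ∀ a b → (b ≡ true → a ≡ true) → ⟦ a ∧ not b ⟧ + (+ 1 - ⟦ a ⟧) ≡ ⟦ not b ⟧
        combine true true _ = refl
        combine true false _ = refl
        combine false true h with h refl
        ... | ()
        combine false false _ = refl

    r-sum : ∀ s m → 1 ≤ m → sum (λ t → rval s m (index t)) ≡ Nval s m + + 1
    r-sum s m 1≤m = begin
      rval s m (suc q) + sum {q} (λ u → rval s m (suc (toℕ u)))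
        ≡⟨ cong₂ _+_ (cong (λ b → if b then Nover s m else Nover s m + + 1) (n<ᵇn≡false (suc q)))
                     (sum-cong-≗ {q} (λ u → cong (λ b → if b then Nover s m else Nover s m + + 1)
                                             (Equivalence.to T-≡ (ℕP.<⇒<ᵇ (s≤s (FP.toℕ<n u)))))) ⟩
      Nover s m + + 1 + sum {q} (λ _ → Nover s m)  ≡⟨ cong (λ z → Nover s m + + 1 + z) (sum-const q (Nover s m)) ⟩
      Nover s m + + 1 + + q * Nover s m            ≡⟨ regroup (+ q) (Nover s m) ⟩
      (+ 1 + + q) * Nover s m + + 1                ≡⟨ cong (λ z → z * Nover s m + + 1) (ℤP.pos-+ 1 q) ⟨
      + suc q * Nover s m + + 1                    ≡⟨ cong (_+ + 1) (p*Nover≡Nval q s m 1≤m) ⟩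
      Nval s m + + 1                               ∎
      where regroup : ∀ Q X → X + + 1 + Q * X ≡ (+ 1 + Q) * X + + 1
            regroup = solve-∀

  module FeasibleEigenvalues (q : ℕ) (p-prime : Prime (suc q)) (m : ℕ) (1≤m : 1 ≤ m) (s : Bool)
                             (f : Vec (Fin (suc q)) (2 ℕ.* m) → Fin (suc q)) (feasible : GF.Feasible (suc q) s m f)
                             (x : Vec (Fin (suc q)) (2 ℕ.* m)) (x≢0 : x ≢ GF.V0 (suc q) (2 ℕ.* m)) where
    open GF (suc q)
    open ModularArithmetic (suc q) using (1F)
    open Vectors (suc q)
    open VectorSums (suc q)
    open GroupRing (suc q)
    open Cyclotomic q (prime[1+q]⇒1≤q p-prime) using (toℤ; toℤ-cong; toℤ-intζ; toℤ-δ0; toℤ-sum)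
    open Characters (suc q) x using (φ; χ; fibre; χ-V0)
    open FibreConstant q p-prime x x≢0 using (fibre-constant)
    open Classes q f

    n : ℕ
    n = 2 ℕ.* m

    N : ℤ
    N = Nval s m

    r : ℕ → ℤ
    r = rval s m

    f-even : Even f
    f-even = proj₁ feasible

    f-V0 : f (V0 n) ≡ 0F
    f-V0 = proj₁ (proj₂ feasible)

    srg : ∀ i → 1 ≤ i → i ≤ suc q →
          IsSRG (allVecs n) _==V_ (adj f i) (N * N) ((N - + 1) * r i) (N + r i * r i - + 3 * r i) (r i * r i - r i)
    srg = proj₂ (proj₂ feasible)

    θ : ℕ → ℤ[C]
    θ i = λcoeff f i x

    dichotomy : ∀ i → 1 ≤ i → i ≤ suc q → θ i ≈ζ intζ (N - r i) ⊎ θ i ≈ζ intζ (- r i)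
    dichotomy i 1≤i i≤p = EigenvalueDichotomy.eigenvalue-dichotomy q p-prime (ind f i) (ind-V0 f-V0 i 1≤i)
                            (ind-even f-even i) x x≢0 N (r i) (srg i 1≤i i≤p)

    classify : ∀ t → θ (index t) ≈ζ intζ (N - r (index t)) ⊎ θ (index t) ≈ζ intζ (- r (index t))
    classify t = dichotomy (index t) (proj₁ (index-bounds t)) (proj₂ (index-bounds t))

    large? : Fin (suc q) → Bool
    large? t = inj₁? (classify t)

    θ-sum : ∀ k → sum (λ t → θ (index t) k) ≡ fibre k - δ 0F k
    θ-sum k = begin
      sum (λ t → θ (index t) k)
        ≡⟨ sum-cong-≗ (λ t → trans (count≡vsum n _) (vsum-cong n (λ y → ⟦∧⟧ (ind f (index t) y) (φ y ==F k)))) ⟩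
      sum (λ t → vsum n (λ y → ⟦ ind f (index t) y ⟧ * χ k y))
        ≡⟨ vsum-sum-comm n (λ t y → ⟦ ind f (index t) y ⟧ * χ k y) ⟨
      vsum n (λ y → sum (λ t → ⟦ ind f (index t) y ⟧ * χ k y))
        ≡⟨ vsum-cong n (λ y → trans (sum-*ʳ (χ k y) (λ t → ⟦ ind f (index t) y ⟧)) (cong (_* χ k y) (classes-partition f-V0 y))) ⟩
      vsum n (λ y → ⟦ not (y ==V V0 n) ⟧ * χ k y)
        ≡⟨ vsum-cong n (λ y → trans (cong (_* χ k y) (⟦not⟧ (y ==V V0 n))) (split ⟦ y ==V V0 n ⟧ (χ k y))) ⟩
      vsum n (λ y → χ k y + - + 1 * (⟦ y ==V V0 n ⟧ * χ k y))
        ≡⟨ vsum-distrib-+ n (χ k) _ ⟩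
      fibre k + vsum n (λ y → - + 1 * (⟦ y ==V V0 n ⟧ * χ k y))
        ≡⟨ cong (λ z → fibre k + z) (trans (vsum-*ˡ n (- + 1) _) (cong (- + 1 *_) (trans (vsum-δ n (V0 n) (χ k)) (χ-V0 k)))) ⟩
      fibre k + - + 1 * δ 0F k
        ≡⟨ cong (λ z → fibre k + z) (ℤP.-1*i≡-i (δ 0F k)) ⟩
      fibre k - δ 0F k ∎
      where split : ∀ b c → (+ 1 - b) * c ≡ c + - + 1 * (b * c)
            split = solve-∀

    toℤ-θ-sum : sum (λ t → toℤ (θ (index t))) ≡ - + 1
    toℤ-θ-sum = begin
      sum (λ t → toℤ (θ (index t)))                ≡⟨ toℤ-sum (λ t → θ (index t)) ⟨
      toℤ (λ k → sum (λ t → θ (index t) k))        ≡⟨ cong₂ _-_ (θ-sum 0F) (θ-sum 1F) ⟩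
      (fibre 0F - δ 0F 0F) - (fibre 1F - δ 0F 1F)   ≡⟨ cong (λ z → (fibre 0F - δ 0F 0F) - (z - δ 0F 1F)) (fibre-constant 1F) ⟩
      (fibre 0F - δ 0F 0F) - (fibre 0F - δ 0F 1F)   ≡⟨ cancel (fibre 0F) (δ 0F 0F) (δ 0F 1F) ⟩
      - toℤ (δ 0F)                                  ≡⟨ cong -_ toℤ-δ0 ⟩
      - + 1 ∎
      where cancel : ∀ h a b → (h - a) - (h - b) ≡ - (a - b)
            cancel = solve-∀

    toℤ-θ+r : ∀ i (d : θ i ≈ζ intζ (N - r i) ⊎ θ i ≈ζ intζ (- r i)) → toℤ (θ i) + r i ≡ N * ⟦ inj₁? d ⟧
    toℤ-θ+r i (inj₁ θ≈N-r) = trans (cong (_+ r i) (trans (toℤ-cong (θ i) (intζ (N - r i)) θ≈N-r) (toℤ-intζ (N - r i))))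
                                   (cancel N (r i))
      where cancel : ∀ N r → N - r + r ≡ N * + 1
            cancel = solve-∀
    toℤ-θ+r i (inj₂ θ≈-r) = trans (cong (_+ r i) (trans (toℤ-cong (θ i) (intζ (- r i)) θ≈-r) (toℤ-intζ (- r i))))
                                  (cancel N (r i))
      where cancel : ∀ N r → - r + r ≡ N * + 0
            cancel = solve-∀

    -- Each toℤ (θ i) + r i is 0 or N, and their sum is -1 + (N + 1) = N.
    exactly-one-large : sum (⟦_⟧ ∘ large?) ≡ + 1
    exactly-one-large = ℤP.*-cancelˡ-≡ N (sum (⟦_⟧ ∘ large?)) (+ 1) {{ℤ.≢-nonZero (Nval≢0 q s m)}} (begin
      N * sum (⟦_⟧ ∘ large?)                               ≡⟨ sum-*ˡ N (⟦_⟧ ∘ large?) ⟨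
      sum (λ t → N * ⟦ large? t ⟧)                         ≡⟨ sum-cong-≗ (λ t → sym (toℤ-θ+r (index t) (classify t))) ⟩
      sum (λ t → toℤ (θ (index t)) + r (index t))          ≡⟨ ∑-distrib-+ (λ t → toℤ (θ (index t))) (λ t → r (index t)) ⟩
      sum (λ t → toℤ (θ (index t))) + sum (λ t → r (index t))  ≡⟨ cong₂ _+_ toℤ-θ-sum (r-sum s m 1≤m) ⟩
      - + 1 + (N + + 1)                                    ≡⟨ simplify N ⟩
      N * + 1                                              ∎)
      where simplify : ∀ N → - + 1 + (N + + 1) ≡ N * + 1
            simplify = solve-∀

    large⇒ : ∀ t → large? t ≡ true → θ (index t) ≈ζ intζ (N - r (index t))
    large⇒ t = inj₁?≡true⇒ (classify t)

    small⇒ : ∀ t → large? t ≡ false → θ (index t) ≈ζ intζ (- r (index t))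
    small⇒ t = inj₁?≡false⇒ (classify t)

    not-both : ∀ i → θ i ≈ζ intζ (N - r i) → ¬ θ i ≈ζ intζ (- r i)
    not-both i θ≈N-r θ≈-r = Nval≢0 q s m (cancel N (r i) (begin
      N - r i                ≡⟨ toℤ-intζ (N - r i) ⟨
      toℤ (intζ (N - r i))   ≡⟨ toℤ-cong (θ i) (intζ (N - r i)) θ≈N-r ⟨
      toℤ (θ i)              ≡⟨ toℤ-cong (θ i) (intζ (- r i)) θ≈-r ⟩
      toℤ (intζ (- r i))     ≡⟨ toℤ-intζ (- r i) ⟩
      - r i                  ∎))
      where
      regroup : ∀ N r → N ≡ N - r + r
      regroup = solve-∀
      cancel : ∀ N r → N - r ≡ - r → N ≡ + 0
      cancel N r e = trans (regroup N r) (trans (cong (_+ r) e) (ℤP.+-inverseˡ r))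

    small-elsewhere : ∀ t → (∀ u → u ≢ t → large? u ≡ false) →
                      ∀ i → 1 ≤ i → i ≤ suc q → i ≢ index t → θ i ≈ζ intζ (- r i)
    small-elsewhere t others i 1≤i i≤p i≢j =
      let u , index-u≡i = index-surjective i 1≤i i≤p in
      subst (λ k → θ k ≈ζ intζ (- r k)) index-u≡i
            (small⇒ u (others u (λ u≡t → i≢j (trans (sym index-u≡i) (cong index u≡t)))))

    large-unique : ∀ i j → 1 ≤ j → j ≤ suc q → θ j ≈ζ intζ (N - r j) →
                   (∀ k → 1 ≤ k → k ≤ suc q → k ≢ i → θ k ≈ζ intζ (- r k)) → i ≡ j
    large-unique i j 1≤j j≤p θj-large others with i ℕ.≟ j
    ... | yes i≡j = i≡j
    ... | no i≢j = ⊥-elim (not-both j θj-large (others j 1≤j j≤p (i≢j ∘ sym)))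

open import Defs
open import Data.Bool using (Bool)
open import Data.Nat using (ℕ; NonZero; _≤_; _<_; _*_; suc; s≤s)
open import Data.Nat.Primality using (Prime)
open import Data.Integer using (ℤ; -_; _-_)
open import Data.Fin using (Fin)
open import Data.Vec using (Vec)
open import Data.Product using (Σ; _×_; _,_; proj₁; proj₂)
open import Relation.Binary.PropositionalEquality using (_≡_; _≢_)

proposition5p1 : (p : ℕ) .{{_ : NonZero p}} → Prime p → 2 < p →
  (m : ℕ) → 1 ≤ m → (s : Bool) →
  (f : Vec (Fin p) (2 * m) → Fin p) → GF.Feasible p s m f →
  (x : Vec (Fin p) (2 * m)) → x ≢ GF.V0 p (2 * m) →
  Σ ℕ λ j →
    ((1 ≤ j × j ≤ p) ×
     (GF._≈ζ_ p (GF.λcoeff p f j x) (GF.intζ p (GF.Nval p s m - GF.rval p s m j)) ×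
      (∀ i → 1 ≤ i → i ≤ p → i ≢ j →
        GF._≈ζ_ p (GF.λcoeff p f i x) (GF.intζ p (- GF.rval p s m i))))) ×
    (∀ j′ → 1 ≤ j′ → j′ ≤ p →
      GF._≈ζ_ p (GF.λcoeff p f j′ x) (GF.intζ p (GF.Nval p s m - GF.rval p s m j′)) →
      (∀ i → 1 ≤ i → i ≤ p → i ≢ j′ →
        GF._≈ζ_ p (GF.λcoeff p f i x) (GF.intζ p (- GF.rval p s m i))) →
      j′ ≡ j)
-- The hypothesis 2 < p only serves to write p = suc q.
proposition5p1 (suc q) p-prime (s≤s _) m 1≤m s f feasible x x≢0 =
  let t , large-t , others = sum-iverson≡1 large? exactly-one-large in
  index t , (index-bounds t , large⇒ t large-t , small-elsewhere t others) ,
  λ j′ _ _ _ small-except-j′ → large-unique j′ (index t) (proj₁ (index-bounds t)) (proj₂ (index-bounds t))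
                                             (large⇒ t large-t) small-except-j′
  where
  open FeasibleEigenvalues q p-prime m 1≤m s f feasible x x≢0
  open Classes q f using (index; index-bounds)
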